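{- The algorithm $\mathit{process\_subtree}$ (including reading the input and computing initial demands, then calling $\mathit{process\_subtree}(r)$) runs in time $O(n\log n+\mathit{OPT}\log n)$, where $\mathit{OPT}$ is the minimum number of moves of a feasible plan for the Unlabeled Pebble Motion on Trees instance with the same tree, starting nodes and targets.
   Context: Computational model: a node reference uses $O(\log n)$ bits, reading/writing one takes $O(\log n)$ time. Unlabeled Pebble Motion on Trees: tree $T=(V,E)$, $n$ nodes, $k$ pebbles on distinct nodes, $k$ distinct targets; a move moves a pebble to an adjacent pebble-free node; $\mathit{OPT}$ is the minimum number of moves after which every pebble is on a target. Unlabeled MAPF on the tree: same data with agents; discrete time; at each timestep each agent waits or moves to an adjacent node; feasibility means no two agents share a node at the same time, no two agents traverse an edge in opposite directions in the same timestep, and eventually all agents rest on targets. Fix root $r$; $T_u$ the subtree at $u$; $agent(u),target(u)\in\{0,1\}$; demand $d(u)=\sum_{v\in T_u}target(v)-\sum_{v\in T_u}agent(v)$. Each node has a list $l(u)$ (initially empty, $\max$ of empty list $=0$) and integer $s(u)$ (initially $0$). $\mathit{send\_agent}(u,t)$: if $d(u)<0$: append $t+1$ to $l(parent(u))$, output move $(u,parent(u),t)$, $d(u)\gets d(u)+1$; else if a child $v$ with $d(v)>0$ exists: pick one, append $t+1$ to $l(v)$, output move $(u,v,t)$, $d(v)\gets d(v)-1$; else nothing. $\mathit{process\_subtree}(u)$: if $agent(u)=1$ insert $s(u)$ at the start of $l(u)$; for each child $v$ with $d(v)<0$: $s(v)\gets\max(s(u)-1,\max l(u),0)$, call $\mathit{process\_subtree}(v)$;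 for each $t\in l(u)$ in order call $\mathit{send\_agent}(u,t)$; mark $u$ processed; call $\mathit{process\_subtree}(v)$ for each unprocessed child $v$. Move $(u,v,t)$ means an agent leaves $u$ at time $t$ and arrives at $v$ at time $t+1$. -}

module Defs where

open import Data.Nat as ℕ using (ℕ; zero; suc; _+_; _*_; _∸_; _⊔_; _≤_)
open import Data.Integer as ℤ using (ℤ; +_; -[1+_])
open import Data.Fin using (Fin; _≟_)
open import Data.Bool using (Bool; true; false; if_then_else_)
open import Data.List using (List; []; _∷_; _++_; [_]; length)
open import Data.List.Membership.Propositional using (_∈_)
open import Data.Maybe using (Maybe; just; nothing)
open import Data.Product using (_×_; _,_; Σ; proj₁; proj₂)
open import Data.Sum using (_⊎_)
open import Data.Unit using (⊤; tt)
open import Relation.Nullary using (does)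
open import Relation.Binary.PropositionalEquality using (_≡_)

Edge : ℕ → Set
Edge n = Fin n × Fin n

Adjacent : {n : ℕ} → List (Edge n) → Fin n → Fin n → Set
Adjacent E u v = ((u , v) ∈ E) ⊎ ((v , u) ∈ E)

data Connected {n : ℕ} (E : List (Edge n)) : Fin n → Fin n → Set where
  here  : ∀ {u} → Connected E u u
  there : ∀ {u v w} → Adjacent E u v → Connected E v w → Connected E u w

IsTree : (n : ℕ) → List (Edge n) → Set
IsTree n E = (length E ≡ n ∸ 1) × (∀ u v → Connected E u v)

Config : ℕ → Set
Config n = Fin n → Bool

upd : {n : ℕ} {A : Set} → (Fin n → A) → Fin n → A → Fin n → A
upd f u a x = if does (x ≟ u) then a else f x

mem : {n : ℕ} → List (Fin n) → Fin n → Bool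
mem []       x = false
mem (y ∷ ys) x = if does (x ≟ y) then true else mem ys x

moveConf : {n : ℕ} → Config n → Fin n → Fin n → Config n
moveConf c u v = upd (upd c u false) v true

data Reaches {n : ℕ} (E : List (Edge n)) (tgt : Config n)
       : Config n → List (Edge n) → Set where
  done : ∀ {c} → (∀ x → c x ≡ tgt x) → Reaches E tgt c []
  step : ∀ {c u v ms} → c u ≡ true → c v ≡ false → Adjacent E u v →
         Reaches E tgt (moveConf c u v) ms → Reaches E tgt c ((u , v) ∷ ms)

IsOPT : (n : ℕ) → List (Edge n) → (agents targets : List (Fin n)) → ℕ → Set
IsOPT n E A T opt =
  Σ (List (Edge n)) (λ plan → Reaches E (mem T) (mem A) plan × length plan ≡ opt)
  × (∀ plan → Reaches E (mem T) (mem A) plan → opt ≤ length plan)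

-- Cost model: a state monad in which every elementary operation (reading
-- or writing one cell of a per-node array, one loop iteration, one output
-- move) costs one tick; one tick = O(log n) time (node references /
-- integers of O(log n) bits).

module Algorithm (n : ℕ) where

  Move : Set
  Move = Fin n × Fin n × ℕ

  record St : Set where
    field
      ticks     : ℕ
      adj       : Fin n → List (Fin n)
      children  : Fin n → List (Fin n)
      pend      : Fin n → List (Fin n)   -- children not yet known to have d ≤ 0
      parent    : Fin n → Maybe (Fin n)
      visited   : Fin n → Bool
      agentA    : Fin n → Bool
      targetA   : Fin n → Bool
      processed : Fin n → Bool
      dem       : Fin n → ℤ
      lst       : Fin n → List ℕ
      maxl      : Fin n → ℕ              -- max of lst (0 for empty list)
      sv        : Fin n → ℕ
      out       : List Move              -- output moves, most recent first
  open St

  st₀ : St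
  st₀ = record
    { ticks = 0 ; adj = λ _ → [] ; children = λ _ → [] ; pend = λ _ → []
    ; parent = λ _ → nothing ; visited = λ _ → false ; agentA = λ _ → false
    ; targetA = λ _ → false ; processed = λ _ → false ; dem = λ _ → + 0
    ; lst = λ _ → [] ; maxl = λ _ → 0 ; sv = λ _ → 0 ; out = [] }

  M : Set → Set
  M A = St → A × St

  return : {A : Set} → A → M A
  return a st = a , st

  _>>=_ : {A B : Set} → M A → (A → M B) → M B
  (m >>= f) st = f (proj₁ (m st)) (proj₂ (m st))

  _>>_ : {A B : Set} → M A → M B → M B
  m >> k = m >>= λ _ → k

  tick : M ⊤
  tick st = tt , record st { ticks = suc (ticks st) }

  when : Bool → M ⊤ → M ⊤
  when b m = if b then m else return tt

  whenJust : {X : Set} → Maybe X → (X → M ⊤) → M ⊤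
  whenJust nothing  f = return tt
  whenJust (just x) f = f x

  forM_ : {X : Set} → List X → (X → M ⊤) → M ⊤
  forM_ []       f = return tt
  forM_ (x ∷ xs) f = tick >> (f x >> forM_ xs f)

  rd : {A : Set} → (St → Fin n → A) → Fin n → M A
  rd fld u = tick >> (λ st → fld st u , st)

  setAdj setChildren setPend : Fin n → List (Fin n) → M ⊤
  setAdj u x = tick >> λ st → tt , record st { adj = upd (adj st) u x }
  setChildren u x = tick >> λ st → tt , record st { children = upd (children st) u x }
  setPend u x = tick >> λ st → tt , record st { pend = upd (pend st) u x }

  setParent : Fin n → Maybe (Fin n) → M ⊤
  setParent u x = tick >> λ st → tt , record st { parent = upd (parent st) u x }

  setVisited setAgent setTarget setProcessed : Fin n → Bool → M ⊤
  setVisited u x = tick >> λ st → tt , record st { visited = upd (visited st) u x }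
  setAgent u x = tick >> λ st → tt , record st { agentA = upd (agentA st) u x }
  setTarget u x = tick >> λ st → tt , record st { targetA = upd (targetA st) u x }
  setProcessed u x = tick >> λ st → tt , record st { processed = upd (processed st) u x }

  setD : Fin n → ℤ → M ⊤
  setD u x = tick >> λ st → tt , record st { dem = upd (dem st) u x }

  setL : Fin n → List ℕ → M ⊤
  setL u x = tick >> λ st → tt , record st { lst = upd (lst st) u x }

  setMaxL setS : Fin n → ℕ → M ⊤
  setMaxL u x = tick >> λ st → tt , record st { maxl = upd (maxl st) u x }
  setS u x = tick >> λ st → tt , record st { sv = upd (sv st) u x }

  output : Move → M ⊤
  output mv = tick >> λ st → tt , record st { out = mv ∷ out st }

  appendL : Fin n → ℕ → M ⊤
  appendL u x = do
    ls ← rd lst u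
    setL u (ls ++ [ x ])
    m ← rd maxl u
    setMaxL u (m ⊔ x)

  prependL : Fin n → ℕ → M ⊤
  prependL u x = do
    ls ← rd lst u
    setL u (x ∷ ls)
    m ← rd maxl u
    setMaxL u (m ⊔ x)

  isNeg isPos : ℤ → Bool
  isNeg -[1+ _ ]    = true
  isNeg (+ _)       = false
  isPos (+ suc _)   = true
  isPos _           = false

  b2z : Bool → ℤ
  b2z true  = + 1
  b2z false = + 0

  readInput : List (Edge n) → List (Fin n) → List (Fin n) → M ⊤
  readInput E A T = do
    forM_ E (λ { (a , b) → do
      as ← rd adj a
      setAdj a (b ∷ as)
      bs ← rd adj b
      setAdj b (a ∷ bs) })
    forM_ A (λ a → setAgent a true)
    forM_ T (λ t → setTarget t true)

  -- rooting the tree at r (iterative DFS; a node is pushed only once)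

  visitNbrs : Fin n → List (Fin n) → List (Fin n) → M (List (Fin n))
  visitNbrs u []       stk = return stk
  visitNbrs u (w ∷ ws) stk = do
    tick
    vw ← rd visited w
    if vw then visitNbrs u ws stk else (do
      setVisited w true
      setParent w (just u)
      cs ← rd children u
      setChildren u (w ∷ cs)
      visitNbrs u ws (w ∷ stk))

  -- returns the nodes in reverse popping order (children before parents)
  dfs : ℕ → List (Fin n) → List (Fin n) → M (List (Fin n))
  dfs zero    stk      acc = return acc
  dfs (suc f) []       acc = return acc
  dfs (suc f) (u ∷ stk) acc = do
    tick
    ns ← rd adj u
    stk' ← visitNbrs u ns stk
    dfs f stk' (u ∷ acc)

  -- initial demands d(u) = Σ target - Σ agent over T_u

  initPass : List (Fin n) → M ⊤
  initPass order = forM_ order (λ u → do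
    a ← rd agentA u
    t ← rd targetA u
    setD u (b2z t ℤ.- b2z a)
    cs ← rd children u
    setPend u cs)

  accPass : List (Fin n) → M ⊤
  accPass order = forM_ order (λ u → do
    du ← rd dem u
    p ← rd parent u
    whenJust p (λ q → do
      dq ← rd dem q
      setD q (dq ℤ.+ du)))

  scan : List (Fin n) → M (Maybe (Fin n) × List (Fin n))
  scan []       = return (nothing , [])
  scan (v ∷ vs) = do
    tick
    dv ← rd dem v
    if isPos dv then return (just v , v ∷ vs) else scan vs

  findPos : Fin n → M (Maybe (Fin n))
  findPos u = do
    ps ← rd pend u
    res ← scan ps
    setPend u (proj₂ res)
    return (proj₁ res)

  sendAgent : Fin n → ℕ → M ⊤
  sendAgent u t = do
    du ← rd dem u
    if isNeg du
      then (do
        p ← rd parent u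
        whenJust p (λ q → do
          appendL q (suc t)
          output (u , q , t)
          setD u (du ℤ.+ + 1)))
      else (do
        mv ← findPos u
        whenJust mv (λ v → do
          appendL v (suc t)
          output (u , v , t)
          dv ← rd dem v
          setD v (dv ℤ.- + 1)))

  -- process_subtree (the fuel bounds the recursion depth; depth ≤ n)

  processSubtree : ℕ → Fin n → M ⊤
  processSubtree zero    u = return tt
  processSubtree (suc f) u = do
    a ← rd agentA u
    when a (do
      su ← rd sv u
      prependL u su)
    cs ← rd children u
    forM_ cs (λ v → do
      dv ← rd dem v
      when (isNeg dv) (do
        su ← rd sv u
        m ← rd maxl u
        setS v ((su ∸ 1) ⊔ m)
        processSubtree f v))
    ls ← rd lst u
    forM_ ls (λ t → sendAgent u t)
    setProcessed u true
    forM_ cs (λ v → do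
      pv ← rd processed v
      when (if pv then false else true) (processSubtree f v))

  algorithm : List (Edge n) → Fin n → List (Fin n) → List (Fin n) → M ⊤
  algorithm E r A T = do
    readInput E A T
    setVisited r true
    order ← dfs (suc n) [ r ] []
    initPass order
    accPass order
    processSubtree (suc n) r

  steps : List (Edge n) → Fin n → List (Fin n) → List (Fin n) → ℕ
  steps E r A T = St.ticks (proj₂ (algorithm E r A T st₀))

  outputMoves : List (Edge n) → Fin n → List (Fin n) → List (Fin n) → List Move
  outputMoves E r A T = St.out (proj₂ (algorithm E r A T st₀))

runningTime : (n : ℕ) → List (Edge n) → Fin n → List (Fin n) → List (Fin n) → ℕ
runningTime n E r A T = Algorithm.steps n E r A T * ⌈log₂ n ⌉
  where open import Data.Nat.Logarithm using (⌈log₂_⌉)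

module Submission where

-- Running time = (number of elementary operations) · ⌈log₂ n⌉, so it suffices to count at most 59 (n + OPT)
-- operations.  Reading the input, rooting the tree by depth-first search and computing the demands cost O(n),
-- as a tree has n − 1 edges.  process_subtree is analysed with a potential: every node u holds 18 |d(u)|, plus,
-- until it is processed, enough to pay for its own setup, its children and one send_agent per entry of l(u);
-- each send_agent lowers some |d(v)| by one, which pays for it and for the list entry it creates.  The initial
-- potential is O(n + Σᵤ |d(u)|), and Σᵤ |d(u)| ≤ OPT: every edge is the parent edge of exactly one node u, any
-- plan moves a net −d(u) pebbles across it, and each move crosses one edge.

open import Algebra.Bundles using (CommutativeMonoid)
open import Data.Bool using (Bool; true; false; if_then_else_; _∨_)
open import Data.Bool.Properties using (∨-zeroʳ; ∨-identityʳ)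
open import Data.Empty using (⊥)
open import Data.Fin using (Fin; zero; suc; _≟_; punchIn; punchOut)
open import Data.Fin.Properties using (any?; punchInᵢ≢i; punchIn-injective; punchOut-injective; injective⇒≤)
open import Data.Integer as ℤ using (ℤ; +_; -[1+_]; ∣_∣)
import Data.Integer.Properties as ℤₚ
import Data.Integer.Tactic.RingSolver as ℤRing
open import Data.List using (List; []; _∷_; _++_; [_]; length; lookup; map)
open import Data.List.Properties using (++-identityʳ; ++-assoc; length-map; length-++)
open import Data.List.Membership.Propositional using (_∈_; _∉_)
open import Data.List.Membership.Propositional.Properties using (∈-++⁺ˡ; ∈-++⁺ʳ; ∈-++⁻)
open import Data.List.Membership.DecPropositional using () renaming (_∈?_ to ∈-dec)
open import Data.List.Relation.Unary.All using ([]; _∷_)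
open import Data.List.Relation.Unary.All.Properties using (All¬⇒¬Any; ¬Any⇒All¬)
open import Data.List.Relation.Unary.Any using (here; there; index)
open import Data.List.Relation.Unary.Any.Properties using (lookup-index)
open import Data.List.Relation.Unary.Unique.Propositional using (Unique; []; _∷_; head; tail)
open import Data.Maybe using (Maybe; just; nothing)
open import Data.Maybe.Properties using (just-injective) renaming (≡-dec to ≡-decₘ)
open import Data.Nat using (ℕ; zero; suc; _+_; _*_; _∸_; _⊔_; _≤_; _<_; z≤n; s≤s)
open import Data.Nat.Logarithm using (⌈log₂_⌉)
open import Data.Nat.Properties
  using (≤-refl; ≤-trans; ≤-reflexive; <⇒≤; <-irrefl; <-trans; n≤1+n; 1+n≰n; m≤m+n; m≤n+m;
         +-mono-≤; +-monoˡ-≤; +-monoʳ-≤; *-monoʳ-≤; *-monoˡ-≤; +-identityʳ; +-comm; +-assoc; +-suc;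
         +-cancelʳ-≤; +-cancelʳ-≡; *-identityʳ; +-0-commutativeMonoid; +-*-semiring; module ≤-Reasoning)
open import Data.Nat.Tactic.RingSolver using (solve-∀)
open import Data.Product using (Σ; ∃; _×_; _,_; proj₁; proj₂)
open import Data.Sum using (_⊎_; inj₁; inj₂)
import Data.Sum as Sum
open import Data.Unit using (⊤)
open import Data.Vec.Functional using (removeAt)
open import Function using (_∘_)
open import Function.Definitions using (Injective)
open import Relation.Nullary using (¬_; does; yes; no; contradiction)
open import Relation.Nullary.Decidable using (dec-true; dec-false)
open import Relation.Binary.PropositionalEquality
  using (_≡_; _≢_; refl; sym; trans; cong; cong₂; cong-app; subst; subst₂; module ≡-Reasoning)
open import Defs

-- Finite sums

module CommutativeMonoidSum {c ℓ} (M : CommutativeMonoid c ℓ) where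
  open CommutativeMonoid M using (Carrier; _≈_; setoid; ∙-cong; ∙-congʳ; ∙-congˡ; identityˡ; identityʳ)
    renaming (_∙_ to _+ᴹ_; ε to 0ᴹ; refl to ≈-refl; sym to ≈-sym)
  open import Algebra.Properties.CommutativeMonoid.Sum M using (sum; sum-remove; sum-cong-≋; sum-replicate-zero)
  open import Algebra.Solver.CommutativeMonoid M using (solve; _⊕_; _⊜_)
  open import Relation.Binary.Reasoning.Setoid setoid

  sum-except : ∀ {n} (f g : Fin n → Carrier) u → (∀ x → x ≢ u → f x ≈ g x) →
               sum f +ᴹ g u ≈ sum g +ᴹ f u
  sum-except {suc n} f g u f≈g = begin
    sum f +ᴹ g u                        ≈⟨ ∙-congʳ (sum-remove f) ⟩
    (f u +ᴹ sum (removeAt f u)) +ᴹ g u  ≈⟨ ∙-congʳ (∙-congˡ (sum-cong-≋ (λ i → f≈g _ (punchInᵢ≢i u i)))) ⟩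
    (f u +ᴹ sum (removeAt g u)) +ᴹ g u  ≈⟨ solve 3 (λ a r b → (a ⊕ r) ⊕ b ⊜ (b ⊕ r) ⊕ a) ≈-refl (f u) _ (g u) ⟩
    (g u +ᴹ sum (removeAt g u)) +ᴹ f u  ≈⟨ ∙-congʳ (≈-sym (sum-remove g)) ⟩
    sum g +ᴹ f u                        ∎

  sum-single : ∀ {n} (a : Fin n) v → sum (λ y → if does (y ≟ a) then v else 0ᴹ) ≈ v
  sum-single {n} a v = begin
    sum vₐ                   ≈⟨ ≈-sym (identityʳ _) ⟩
    sum vₐ +ᴹ 0ᴹ             ≈⟨ sum-except vₐ (λ _ → 0ᴹ) a off ⟩
    sum {n} (λ _ → 0ᴹ) +ᴹ vₐ a ≈⟨ ∙-cong (sum-replicate-zero n) on ⟩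
    0ᴹ +ᴹ v                   ≈⟨ identityˡ v ⟩
    v                         ∎
    where
    vₐ : Fin n → Carrier
    vₐ y = if does (y ≟ a) then v else 0ᴹ
    off : ∀ y → y ≢ a → vₐ y ≈ 0ᴹ
    off y y≢a with y ≟ a
    ... | yes y≡a = contradiction y≡a y≢a
    ... | no _    = ≈-refl
    on : vₐ a ≈ v
    on with a ≟ a
    ... | yes _   = ≈-refl
    ... | no a≢a  = contradiction refl a≢a

open import Algebra.Properties.Semiring.Sum +-*-semiring using (sum; sum-cong-≗; sum-replicate-zero; ∑-distrib-+; ∑-comm; *-distribˡ-sum)
open CommutativeMonoidSum +-0-commutativeMonoid


sum-mono-≤ : ∀ {n} {f g : Fin n → ℕ} → (∀ x → f x ≤ g x) → sum f ≤ sum g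
sum-mono-≤ {zero}  f≤g = z≤n
sum-mono-≤ {suc n} f≤g = +-mono-≤ (f≤g zero) (sum-mono-≤ (λ x → f≤g (suc x)))

sum-≤-const : ∀ {n} {f : Fin n → ℕ} c → (∀ x → f x ≤ c) → sum f ≤ n * c
sum-≤-const {zero}  c f≤c = z≤n
sum-≤-const {suc n} c f≤c = +-mono-≤ (f≤c zero) (sum-≤-const c (λ x → f≤c (suc x)))

sum-except-≤ : ∀ {n} (f g : Fin n → ℕ) u {k} → (∀ x → x ≢ u → f x ≡ g x) → f u ≤ g u + k → sum f ≤ sum g + k
sum-except-≤ f g u {k} f≡g fu≤ = +-cancelʳ-≤ (g u) (sum f) (sum g + k) (begin
  sum f + g u          ≡⟨ sum-except f g u f≡g ⟩
  sum g + f u          ≤⟨ +-monoʳ-≤ (sum g) fu≤ ⟩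
  sum g + (g u + k)    ≡⟨ +-assoc (sum g) (g u) k ⟨
  sum g + g u + k      ≡⟨ +-comm-middle (sum g) (g u) k ⟩
  sum g + k + g u      ∎)
  where
  open ≤-Reasoning
  +-comm-middle : ∀ a b c → a + b + c ≡ a + c + b
  +-comm-middle a b c = trans (+-assoc a b c) (trans (cong (λ z → a + z) (+-comm b c)) (sym (+-assoc a c b)))

sum-except-+≤ : ∀ {n} (f g : Fin n → ℕ) u {k} → (∀ x → x ≢ u → f x ≡ g x) → f u + k ≤ g u → sum f + k ≤ sum g
sum-except-+≤ f g u {k} f≡g fu+k≤ = +-cancelʳ-≤ (f u) (sum f + k) (sum g) (begin
  sum f + k + f u      ≡⟨ +-assoc (sum f) k (f u) ⟩
  sum f + (k + f u)    ≡⟨ cong (λ z → sum f + z) (+-comm k (f u)) ⟩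
  sum f + (f u + k)    ≤⟨ +-monoʳ-≤ (sum f) fu+k≤ ⟩
  sum f + g u          ≡⟨ sum-except f g u f≡g ⟩
  sum g + f u          ∎)
  where open ≤-Reasoning

sum-except-≡ : ∀ {n} (f g : Fin n → ℕ) u {a b} → (∀ x → x ≢ u → f x ≡ g x) → f u + a ≡ g u + b → sum f + a ≡ sum g + b
sum-except-≡ f g u {a} {b} f≡g fu+a≡ = +-cancelʳ-≡ (g u) (sum f + a) (sum g + b) (begin
  sum f + a + g u      ≡⟨ +-assoc (sum f) a (g u) ⟩
  sum f + (a + g u)    ≡⟨ cong (λ z → sum f + z) (+-comm a (g u)) ⟩
  sum f + (g u + a)    ≡⟨ +-assoc (sum f) (g u) a ⟨
  sum f + g u + a      ≡⟨ cong (_+ a) (sum-except f g u f≡g) ⟩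
  sum g + f u + a      ≡⟨ +-assoc (sum g) (f u) a ⟩
  sum g + (f u + a)    ≡⟨ cong (λ z → sum g + z) fu+a≡ ⟩
  sum g + (g u + b)    ≡⟨ cong (λ z → sum g + z) (+-comm (g u) b) ⟩
  sum g + (b + g u)    ≡⟨ +-assoc (sum g) b (g u) ⟨
  sum g + b + g u      ∎)
  where open ≡-Reasoning


count : ∀ {n} → Fin n → List (Fin n) → ℕ
count x []       = 0
count x (y ∷ ys) = (if does (x ≟ y) then 1 else 0) + count x ys

sum-count : ∀ {n} (xs : List (Fin n)) → sum (λ x → count x xs) ≡ length xs
sum-count {n} []       = sum-replicate-zero n
sum-count {n} (y ∷ ys) = trans (∑-distrib-+ (λ x → if does (x ≟ y) then 1 else 0) (λ x → count x ys)) (cong₂ _+_ (sum-single y 1) (sum-count ys))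

count-∉ : ∀ {n} {x : Fin n} xs → x ∉ xs → count x xs ≡ 0
count-∉ []       x∉ = refl
count-∉ {x = x} (y ∷ ys) x∉ with x ≟ y
... | yes x≡y = contradiction (here x≡y) x∉
... | no _    = count-∉ ys (λ x∈ → x∉ (there x∈))

count-unique : ∀ {n} (x : Fin n) {xs} → Unique xs → count x xs ≤ 1
count-unique x {[]}     _ = z≤n
count-unique x {y ∷ ys} (y∉ys ∷ !ys) with x ≟ y
... | yes refl = ≤-reflexive (cong suc (count-∉ ys (All¬⇒¬Any y∉ys)))
... | no _     = count-unique x !ys

length-unique : ∀ {n} {xs : List (Fin n)} → Unique xs → length xs ≤ n
length-unique {n} {xs} !xs = begin
  length xs                ≡⟨ sum-count xs ⟨
  sum (λ x → count x xs)   ≤⟨ sum-≤-const 1 (λ x → count-unique x !xs) ⟩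
  n * 1                    ≡⟨ *-identityʳ n ⟩
  n                        ∎
  where open ≤-Reasoning

-- Each node lies in the children list of at most one node, namely its parent.
children-total : ∀ {n} (parent : Fin n → Maybe (Fin n)) (children : Fin n → List (Fin n)) →
                 (∀ {x y} → y ∈ children x → parent y ≡ just x) → (∀ x → Unique (children x)) →
                 sum (λ x → length (children x)) ≤ n
children-total {n} parent children children⇒parent children-unique = begin
  sum (λ x → length (children x))              ≡⟨ sum-cong-≗ (λ x → sum-count (children x)) ⟨
  sum (λ x → sum (λ y → count y (children x))) ≤⟨ sum-mono-≤ (λ x → sum-mono-≤ (λ y → count≤isParent x y)) ⟩
  sum (λ x → sum (λ y → isParent y x))         ≡⟨ ∑-comm (λ x y → isParent y x) ⟩
  sum (λ y → sum (λ x → isParent y x))         ≤⟨ sum-≤-const 1 (λ y → one-parent y (parent y) refl) ⟩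
  n * 1                                        ≡⟨ *-identityʳ n ⟩
  n                                            ∎
  where
  open ≤-Reasoning
  isParent : Fin n → Fin n → ℕ
  isParent y x = if does (≡-decₘ _≟_ (parent y) (just x)) then 1 else 0
  count≤isParent : ∀ x y → count y (children x) ≤ isParent y x
  count≤isParent x y with ∈-dec _≟_ y (children x)
  ... | no y∉ = ≤-trans (≤-reflexive (count-∉ (children x) y∉)) z≤n
  ... | yes y∈ with ≡-decₘ _≟_ (parent y) (just x)
  ...   | yes _     = count-unique y (children-unique x)
  ...   | no y↑̸x   = contradiction (children⇒parent y∈) y↑̸x
  one-parent : ∀ y p → parent y ≡ p → sum (λ x → isParent y x) ≤ 1
  one-parent y nothing  y↑ = ≤-trans (≤-reflexive (trans (sum-cong-≗ no-parent) (sum-replicate-zero n))) z≤n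
    where
    no-parent : ∀ x → isParent y x ≡ 0
    no-parent x with ≡-decₘ _≟_ (parent y) (just x)
    ... | yes y↑x = contradiction (trans (sym y↑) y↑x) λ ()
    ... | no _    = refl
  one-parent y (just p) y↑ = ≤-reflexive (trans (sum-cong-≗ at-p) (sum-single p 1))
    where
    at-p : ∀ x → isParent y x ≡ (if does (x ≟ p) then 1 else 0)
    at-p x with ≡-decₘ _≟_ (parent y) (just x) | x ≟ p
    ... | yes _   | yes _   = refl
    ... | no _    | no _    = refl
    ... | yes y↑x | no x≢p  = contradiction (just-injective (trans (sym y↑x) y↑)) x≢p
    ... | no y↑̸x  | yes refl = contradiction y↑ y↑̸x

open import Data.Integer.Properties using () renaming (+-0-commutativeMonoid to ℤ-+-0-commutativeMonoid)
open import Algebra.Properties.CommutativeMonoid.Sum ℤ-+-0-commutativeMonoid using ()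
  renaming (sum to sumℤ; sum-cong-≗ to sumℤ-cong-≗; ∑-distrib-+ to ∑ℤ-distrib-+; sum-replicate-zero to sumℤ-zero)
module ℤSum = CommutativeMonoidSum ℤ-+-0-commutativeMonoid

upd-≡ : ∀ {n} {A : Set} (f : Fin n → A) u a → upd f u a u ≡ a
upd-≡ f u a with u ≟ u
... | yes _   = refl
... | no u≢u  = contradiction refl u≢u

upd-≢ : ∀ {n} {A : Set} (f : Fin n → A) u a {x} → x ≢ u → upd f u a x ≡ f x
upd-≢ f u a {x} x≢u with x ≟ u
... | yes x≡u = contradiction x≡u x≢u
... | no _    = refl

position : ∀ {n} → List (Fin n) → Fin n → ℕ
position []       x = 0
position (y ∷ ys) x = if does (x ≟ y) then 0 else suc (position ys x)

position-head : ∀ {n} (y : Fin n) ys → position (y ∷ ys) y ≡ 0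
position-head y ys with y ≟ y
... | yes _  = refl
... | no y≢y = contradiction refl y≢y

position-tail : ∀ {n} {x y : Fin n} ys → x ≢ y → position (y ∷ ys) x ≡ suc (position ys x)
position-tail {x = x} {y} ys x≢y with x ≟ y
... | yes x≡y = contradiction x≡y x≢y
... | no _    = refl

position-++ : ∀ {n} {c : Fin n} xs ys → c ∉ xs → position (xs ++ ys) c ≡ length xs + position ys c
position-++ []       ys c∉ = refl
position-++ (x ∷ xs) ys c∉ =
  trans (position-tail (xs ++ ys) (λ c≡x → c∉ (here c≡x))) (cong suc (position-++ xs ys (λ c∈ → c∉ (there c∈))))

position-<-length : ∀ {n} {c : Fin n} xs ys → c ∈ xs → position (xs ++ ys) c < length xs
position-<-length {c = c} (x ∷ xs) ys c∈ with c ≟ x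
... | yes _ = s≤s z≤n
position-<-length (x ∷ xs) ys (here c≡x) | no c≢x = contradiction c≡x c≢x
position-<-length (x ∷ xs) ys (there c∈) | no _   = s≤s (position-<-length xs ys c∈)

unique-middle : ∀ {A : Set} (xs : List A) {y ys} → Unique (xs ++ y ∷ ys) → y ∉ xs
unique-middle (x ∷ xs) (x∉ ∷ _)  (here refl) = All¬⇒¬Any x∉ (∈-++⁺ʳ xs (here refl))
unique-middle (x ∷ xs) (_ ∷ !xs) (there y∈) = unique-middle xs !xs y∈

by-cases-≟ : ∀ {n} {A : Set} (x u : Fin n) → (x ≡ u → A) → (x ≢ u → A) → A
by-cases-≟ x u if-≡ if-≢ with x ≟ u
... | yes x≡u = if-≡ x≡u
... | no x≢u  = if-≢ x≢u

-- Parent edges of a rooted tree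

injective⇒surjective : ∀ {m n} {f : Fin m → Fin n} → n ≤ m → Injective _≡_ _≡_ f → ∀ y → ∃ λ x → f x ≡ y
injective⇒surjective {f = f} n≤m f-inj y with any? (λ x → f x ≟ y)
... | yes hit = hit
injective⇒surjective {n = suc _} {f = f} n≤m f-inj y | no miss =
  contradiction (≤-trans n≤m (injective⇒≤ f⁻ʸ-inj)) 1+n≰n
  where
  y≢f : ∀ x → y ≢ f x
  y≢f x y≡fx = miss (x , sym y≡fx)
  f⁻ʸ-inj : Injective _≡_ _≡_ (λ x → punchOut (y≢f x))
  f⁻ʸ-inj eq = f-inj (punchOut-injective (y≢f _) (y≢f _) eq)

module ParentEdges {m} (E : List (Edge (suc m))) (|E|≡m : length E ≡ m) (r : Fin (suc m))
  (parent : Fin (suc m) → Maybe (Fin (suc m)))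
  (has-parent : ∀ x → x ≢ r → ∃ λ p → parent x ≡ just p)
  (parent-adjacent : ∀ {x p} → parent x ≡ just p → Adjacent E p x)
  (parent-asym : ∀ {x y} → parent x ≡ just y → parent y ≡ just x → ⊥) where

  IsParentEdge : Fin (suc m) → Edge (suc m) → Set
  IsParentEdge x e = ∃ λ p → parent x ≡ just p × (e ≡ (p , x) ⊎ e ≡ (x , p))

  parentEdgeIndex : (k : Fin m) → Σ (Fin (length E)) λ j → IsParentEdge (punchIn r k) (lookup E j)
  parentEdgeIndex k with has-parent (punchIn r k) (punchInᵢ≢i r k)
  ... | p , p-parent with parent-adjacent p-parent
  ...   | inj₁ px∈E = index px∈E , p , p-parent , inj₁ (sym (lookup-index px∈E))
  ...   | inj₂ xp∈E = index xp∈E , p , p-parent , inj₂ (sym (lookup-index xp∈E))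

  parentEdge-injective : ∀ {x y e} → IsParentEdge x e → IsParentEdge y e → x ≡ y
  parentEdge-injective (p , _ , inj₁ refl) (q , _ , inj₁ refl) = refl
  parentEdge-injective (p , _ , inj₂ refl) (q , _ , inj₂ refl) = refl
  parentEdge-injective (p , x↑p , inj₁ refl) (q , p↑x , inj₂ refl) = contradiction p↑x (parent-asym x↑p)
  parentEdge-injective (p , x↑p , inj₂ refl) (q , p↑x , inj₁ refl) = contradiction p↑x (parent-asym x↑p)

  parentEdgeIndex-injective : Injective _≡_ _≡_ (λ k → proj₁ (parentEdgeIndex k))
  parentEdgeIndex-injective {k} {k′} jₖ≡jₖ′ = punchIn-injective r k k′ (parentEdge-injective
    (proj₂ (parentEdgeIndex k)) (subst (IsParentEdge _ ∘ lookup E) (sym jₖ≡jₖ′) (proj₂ (parentEdgeIndex k′))))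

  -- The m non-root nodes have pairwise distinct parent edges among the m edges, so these are all of them.
  parentEdge-surjective : ∀ {e} → e ∈ E → ∃ λ x → IsParentEdge x e
  parentEdge-surjective e∈E
    with k , jₖ≡i ← injective⇒surjective (≤-reflexive |E|≡m) parentEdgeIndex-injective (index e∈E) =
    punchIn r k , subst (IsParentEdge _) (trans (cong (lookup E) jₖ≡i) (sym (lookup-index e∈E))) (proj₂ (parentEdgeIndex k))

  edge⇒parentEdge : ∀ {a b} → Adjacent E a b → parent a ≡ just b ⊎ parent b ≡ just a
  edge⇒parentEdge (inj₁ ab∈E) with parentEdge-surjective ab∈E
  ... | _ , _ , b↑a , inj₁ refl = inj₂ b↑a
  ... | _ , _ , a↑b , inj₂ refl = inj₁ a↑b
  edge⇒parentEdge (inj₂ ba∈E) with parentEdge-surjective ba∈E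
  ... | _ , _ , a↑b , inj₁ refl = inj₁ a↑b
  ... | _ , _ , b↑a , inj₂ refl = inj₂ b↑a

-- Subtree demands and the length of a plan

sumOver : ∀ {n} → List (Fin n) → (Fin n → ℤ) → ℤ
sumOver []       g = + 0
sumOver (x ∷ xs) g = g x ℤ.+ sumOver xs g

sumOver-++ : ∀ {n} (xs ys : List (Fin n)) g → sumOver (xs ++ ys) g ≡ sumOver xs g ℤ.+ sumOver ys g
sumOver-++ []       ys g = sym (ℤₚ.+-identityˡ _)
sumOver-++ (x ∷ xs) ys g = trans (cong (λ s → g x ℤ.+ s) (sumOver-++ xs ys g)) (sym (ℤₚ.+-assoc (g x) _ _))

sumOver-cong : ∀ {n} (xs : List (Fin n)) {f g} → (∀ {c} → c ∈ xs → f c ≡ g c) → sumOver xs f ≡ sumOver xs g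
sumOver-cong []       f≡g = refl
sumOver-cong (x ∷ xs) f≡g = cong₂ ℤ._+_ (f≡g (here refl)) (sumOver-cong xs (λ c∈ → f≡g (there c∈)))

sumOver-complete : ∀ {n} {xs : List (Fin n)} g → Unique xs → (∀ c → c ∉ xs → g c ≡ + 0) → sumOver xs g ≡ sumℤ g
sumOver-complete {n} {[]} g _ off = sym (trans (sumℤ-cong-≗ (λ c → off c (λ ()))) (sumℤ-zero n))
sumOver-complete {xs = y ∷ ys} g (y∉ys ∷ !ys) off = begin
  g y ℤ.+ sumOver ys g   ≡⟨ cong (λ s → g y ℤ.+ s) (sumOver-cong ys (λ c∈ → sym (upd-≢ g y (+ 0) (λ { refl → All¬⇒¬Any y∉ys c∈ })))) ⟩
  g y ℤ.+ sumOver ys g₀  ≡⟨ cong (λ s → g y ℤ.+ s) (sumOver-complete g₀ !ys off₀) ⟩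
  g y ℤ.+ sumℤ g₀        ≡⟨ ℤₚ.+-comm (g y) (sumℤ g₀) ⟩
  sumℤ g₀ ℤ.+ g y        ≡⟨ ℤSum.sum-except g₀ g y (λ _ → upd-≢ g y (+ 0)) ⟩
  sumℤ g ℤ.+ g₀ y        ≡⟨ cong (λ s → sumℤ g ℤ.+ s) (upd-≡ g y (+ 0)) ⟩
  sumℤ g ℤ.+ + 0         ≡⟨ ℤₚ.+-identityʳ _ ⟩
  sumℤ g                 ∎
  where
  open ≡-Reasoning
  g₀ = upd g y (+ 0)
  off₀ : ∀ c → c ∉ ys → g₀ c ≡ + 0
  off₀ c c∉ys with c ≟ y
  ... | yes refl = refl
  ... | no c≢y   = off c λ { (here c≡y) → c≢y c≡y ; (there c∈) → c∉ys c∈ }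

unique-++ˡ : ∀ {A : Set} (xs : List A) {ys} → Unique (xs ++ ys) → Unique xs
unique-++ˡ []       _           = []
unique-++ˡ (x ∷ xs) (x∉ ∷ !xys) = ¬Any⇒All¬ xs (λ x∈ → All¬⇒¬Any x∉ (∈-++⁺ˡ x∈)) ∷ unique-++ˡ xs !xys

module Accumulation {n} (parent : Fin n → Maybe (Fin n)) where

  isParent : Fin n → Fin n → Bool
  isParent c x = does (≡-decₘ _≟_ (parent c) (just x))

  childSum : (Fin n → ℤ) → Fin n → ℤ
  childSum F x = sumℤ (λ c → if isParent c x then F c else + 0)

  childSumOver : List (Fin n) → (Fin n → ℤ) → Fin n → ℤ
  childSumOver cs F x = sumOver cs (λ c → if isParent c x then F c else + 0)

  pushUp : Maybe (Fin n) → Fin n → (Fin n → ℤ) → Fin n → ℤ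
  pushUp nothing  u d = d
  pushUp (just p) u d = upd d p (d p ℤ.+ d u)

  accumulate : List (Fin n) → (Fin n → ℤ) → Fin n → ℤ
  accumulate []       d = d
  accumulate (u ∷ us) d = accumulate us (pushUp (parent u) u d)

  module _ (ord : List (Fin n)) (ord-unique : Unique ord) (ord-complete : ∀ x → x ∈ ord)
           (children-first : ∀ {x p} → parent x ≡ just p → position ord x < position ord p)
           (F base : Fin n → ℤ) (base-flow : ∀ x → base x ≡ childSum F x ℤ.- F x) where

    record Accumulated (pre : List (Fin n)) (d : Fin n → ℤ) : Set where
      field
        settled : ∀ {c} → c ∈ pre → d c ≡ ℤ.- F c
        pending : ∀ {v} → v ∉ pre → d v ≡ base v ℤ.- childSumOver pre F v

    module Step (pre : List (Fin n)) (y : Fin n) (rest : List (Fin n)) (ord≡ : ord ≡ pre ++ y ∷ rest)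
                (d : Fin n → ℤ) (acc : Accumulated pre d) where
      open Accumulated acc

      y∉pre : y ∉ pre
      y∉pre = unique-middle pre (subst Unique ord≡ ord-unique)

      position-y : position ord y ≡ length pre
      position-y = begin
        position ord y                      ≡⟨ cong (λ o → position o y) ord≡ ⟩
        position (pre ++ y ∷ rest) y        ≡⟨ position-++ pre (y ∷ rest) y∉pre ⟩
        length pre + position (y ∷ rest) y  ≡⟨ cong (λ z → length pre + z) (position-head y rest) ⟩
        length pre + 0                      ≡⟨ +-identityʳ _ ⟩
        length pre                          ∎
        where open ≡-Reasoning

      child∈pre : ∀ {c} → parent c ≡ just y → c ∈ pre
      child∈pre {c} c↑y with ∈-dec _≟_ c pre
      ... | yes c∈pre = c∈pre
      ... | no  c∉pre = contradiction refl (<-irrefl′ (begin-strict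
        position ord c                      <⟨ children-first c↑y ⟩
        position ord y                      ≡⟨ position-y ⟩
        length pre                          ≤⟨ m≤m+n _ _ ⟩
        length pre + position (y ∷ rest) c  ≡⟨ position-++ pre (y ∷ rest) c∉pre ⟨
        position (pre ++ y ∷ rest) c        ≡⟨ cong (λ o → position o c) ord≡ ⟨
        position ord c                      ∎))
        where open ≤-Reasoning
              <-irrefl′ : position ord c < position ord c → position ord c ≢ position ord c
              <-irrefl′ lt eq = <-irrefl eq lt

      settled-y : d y ≡ ℤ.- F y
      settled-y = begin
        d y                                    ≡⟨ pending y∉pre ⟩
        base y ℤ.- childSumOver pre F y        ≡⟨ cong (λ s → base y ℤ.- s) (sumOver-complete _ (unique-++ˡ pre (subst Unique ord≡ ord-unique)) non-child) ⟩
        base y ℤ.- childSum F y                ≡⟨ cong (λ z → z ℤ.- childSum F y) (base-flow y) ⟩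
        childSum F y ℤ.- F y ℤ.- childSum F y  ≡⟨ cancel (childSum F y) (F y) ⟩
        ℤ.- F y                                ∎
        where
        open ≡-Reasoning
        non-child : ∀ c → c ∉ pre → (if isParent c y then F c else + 0) ≡ + 0
        non-child c c∉pre with ≡-decₘ _≟_ (parent c) (just y)
        ... | yes c↑y = contradiction (child∈pre c↑y) c∉pre
        ... | no  _   = refl
        cancel : ∀ s f → s ℤ.- f ℤ.- s ≡ ℤ.- f
        cancel = ℤRing.solve-∀

      ∈-snoc : ∀ {c} → c ∈ pre ++ [ y ] → c ∈ pre ⊎ c ≡ y
      ∈-snoc c∈ with ∈-++⁻ pre c∈
      ... | inj₁ c∈pre        = inj₁ c∈pre
      ... | inj₂ (here c≡y)   = inj₂ c≡y

      settled-snoc : ∀ {c} → c ∈ pre ++ [ y ] → d c ≡ ℤ.- F c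
      settled-snoc c∈ with ∈-snoc c∈
      ... | inj₁ c∈pre = settled c∈pre
      ... | inj₂ refl  = settled-y

      parent-later : ∀ {q} → parent y ≡ just q → ∀ {c} → c ∈ pre ++ [ y ] → c ≢ q
      parent-later y↑q c∈ refl with ∈-snoc c∈
      ... | inj₁ q∈pre = <-irrefl refl (<-trans (begin-strict
        position ord _                ≡⟨ cong (λ o → position o _) ord≡ ⟩
        position (pre ++ y ∷ rest) _  <⟨ position-<-length pre (y ∷ rest) q∈pre ⟩
        length pre                    ≡⟨ position-y ⟨
        position ord y                ∎) (children-first y↑q))
        where open ≤-Reasoning
      ... | inj₂ refl  = <-irrefl refl (children-first y↑q)

      childSumOver-snoc : ∀ v → childSumOver (pre ++ [ y ]) F v ≡ childSumOver pre F v ℤ.+ (if isParent y v then F y else + 0)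
      childSumOver-snoc v = trans (sumOver-++ pre [ y ] _) (cong (λ s → childSumOver pre F v ℤ.+ s) (ℤₚ.+-identityʳ _))

      not-parent : ∀ {v} → (∀ {q} → parent y ≡ just q → v ≢ q) → isParent y v ≡ false
      not-parent v-not-parent = dec-false (≡-decₘ _≟_ (parent y) (just _)) (λ y↑v → v-not-parent y↑v refl)

      pending-unchanged : ∀ {v} → v ∉ pre ++ [ y ] → (∀ {q} → parent y ≡ just q → v ≢ q) →
                          d v ≡ base v ℤ.- childSumOver (pre ++ [ y ]) F v
      pending-unchanged {v} v∉ v-not-parent = begin
        d v                                                                        ≡⟨ pending (λ v∈ → v∉ (∈-++⁺ˡ v∈)) ⟩
        base v ℤ.- childSumOver pre F v                                            ≡⟨ cong (λ s → base v ℤ.- s) (ℤₚ.+-identityʳ _) ⟨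
        base v ℤ.- (childSumOver pre F v ℤ.+ + 0)                                  ≡⟨ cong (λ b → base v ℤ.- (childSumOver pre F v ℤ.+ (if b then F y else + 0))) (not-parent v-not-parent) ⟨
        base v ℤ.- (childSumOver pre F v ℤ.+ (if isParent y v then F y else + 0))  ≡⟨ cong (λ s → base v ℤ.- s) (childSumOver-snoc v) ⟨
        base v ℤ.- childSumOver (pre ++ [ y ]) F v                                 ∎
        where open ≡-Reasoning

      pending-parent : ∀ {q} → parent y ≡ just q → q ∉ pre ++ [ y ] →
                       d q ℤ.+ d y ≡ base q ℤ.- childSumOver (pre ++ [ y ]) F q
      pending-parent {q} y↑q q∉ = begin
        d q ℤ.+ d y                                                                ≡⟨ cong₂ ℤ._+_ (pending (λ q∈ → q∉ (∈-++⁺ˡ q∈))) settled-y ⟩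
        base q ℤ.- childSumOver pre F q ℤ.+ ℤ.- F y                                ≡⟨ shift (base q) (childSumOver pre F q) (F y) ⟩
        base q ℤ.- (childSumOver pre F q ℤ.+ F y)                                  ≡⟨ cong (λ b → base q ℤ.- (childSumOver pre F q ℤ.+ (if b then F y else + 0))) (dec-true (≡-decₘ _≟_ (parent y) (just q)) y↑q) ⟨
        base q ℤ.- (childSumOver pre F q ℤ.+ (if isParent y q then F y else + 0))  ≡⟨ cong (λ s → base q ℤ.- s) (childSumOver-snoc q) ⟨
        base q ℤ.- childSumOver (pre ++ [ y ]) F q                                 ∎
        where
        open ≡-Reasoning
        shift : ∀ b s f → b ℤ.- s ℤ.+ ℤ.- f ≡ b ℤ.- (s ℤ.+ f)
        shift = ℤRing.solve-∀

      accumulated-snoc : Accumulated (pre ++ [ y ]) (pushUp (parent y) y d)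
      accumulated-snoc with parent y in y↑
      ... | nothing = record
        { settled = settled-snoc
        ; pending = λ v∉ → pending-unchanged v∉ (λ y↑q → contradiction (trans (sym y↑) y↑q) λ ()) }
      ... | just q = record
        { settled = λ {c} c∈ → trans (upd-≢ d q _ (parent-later y↑ c∈)) (settled-snoc c∈)
        ; pending = λ {v} v∉ → pending-just v v∉ }
        where
        pending-just : ∀ v → v ∉ pre ++ [ y ] → upd d q (d q ℤ.+ d y) v ≡ base v ℤ.- childSumOver (pre ++ [ y ]) F v
        pending-just v v∉ with v ≟ q
        ... | yes refl = pending-parent y↑ v∉
        ... | no v≢q   = pending-unchanged v∉ (λ y↑q′ v≡q′ → v≢q (trans v≡q′ (just-injective (trans (sym y↑q′) y↑))))

    accumulated-rest : ∀ pre rest d → ord ≡ pre ++ rest → Accumulated pre d → ∀ x → accumulate rest d x ≡ ℤ.- F x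
    accumulated-rest pre []         d ord≡ acc x =
      Accumulated.settled acc (subst (x ∈_) (trans ord≡ (++-identityʳ pre)) (ord-complete x))
    accumulated-rest pre (y ∷ rest) d ord≡ acc =
      accumulated-rest (pre ++ [ y ]) rest _ (trans ord≡ (sym (++-assoc pre [ y ] rest))) (Step.accumulated-snoc pre y rest ord≡ d acc)

    accumulate-flow : ∀ x → accumulate ord base x ≡ ℤ.- F x
    accumulate-flow = accumulated-rest [] ord base refl
      record { settled = λ () ; pending = λ {v} _ → sym (ℤₚ.+-identityʳ (base v)) }

module PlanFlow {n} (E : List (Edge n)) (parent : Fin n → Maybe (Fin n))
  (edge⇒parentEdge : ∀ {a b} → Adjacent E a b → parent a ≡ just b ⊎ parent b ≡ just a) where
  open Accumulation parent
  open Algorithm n using (b2z)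

  point : Fin n → ℤ → Fin n → ℤ
  point a v y = if does (y ≟ a) then v else + 0

  -- A move a → b crosses the parent edge of a upwards (+1) or that of b downwards (−1).
  moveFlow : Edge n → Fin n → ℤ
  moveFlow (a , b) = if isParent a b then point a (+ 1) else point b ℤ.-1ℤ

  flow : List (Edge n) → Fin n → ℤ
  flow []      y = + 0
  flow (m ∷ P) y = moveFlow m y ℤ.+ flow P y

  movedEdge : Edge n → Fin n
  movedEdge (a , b) = if isParent a b then a else b

  childSum-point : ∀ a v x → childSum (point a v) x ≡ (if isParent a x then v else + 0)
  childSum-point a v x = trans (sumℤ-cong-≗ pointwise) (ℤSum.sum-single a _)
    where
    pointwise : ∀ c → (if isParent c x then point a v c else + 0) ≡ point a (if isParent a x then v else + 0) c
    pointwise c with c ≟ a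
    ... | yes refl = refl
    ... | no _ with isParent c x
    ...   | true  = refl
    ...   | false = refl

  childSum-+ : ∀ F G x → childSum (λ y → F y ℤ.+ G y) x ≡ childSum F x ℤ.+ childSum G x
  childSum-+ F G x = trans (sumℤ-cong-≗ pointwise) (∑ℤ-distrib-+ (λ c → if isParent c x then F c else + 0) (λ c → if isParent c x then G c else + 0))
    where
    pointwise : ∀ c → (if isParent c x then F c ℤ.+ G c else + 0) ≡ (if isParent c x then F c else + 0) ℤ.+ (if isParent c x then G c else + 0)
    pointwise c with isParent c x
    ... | true  = refl
    ... | false = refl

  childSum-zero : ∀ x → childSum (λ _ → + 0) x ≡ + 0
  childSum-zero x = trans (sumℤ-cong-≗ pointwise) (sumℤ-zero n)
    where
    pointwise : ∀ c → (if isParent c x then + 0 else + 0) ≡ + 0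
    pointwise c with isParent c x
    ... | true  = refl
    ... | false = refl

  parent-point : ∀ {a b} → parent a ≡ just b → ∀ v x → (if isParent a x then v else + 0) ≡ point b v x
  parent-point {a} {b} a↑b v x with ≡-decₘ _≟_ (parent a) (just x) | x ≟ b
  ... | yes _    | yes _   = refl
  ... | no _     | no _    = refl
  ... | yes a↑x  | no x≢b  = contradiction (just-injective (trans (sym a↑x) a↑b)) x≢b
  ... | no ¬a↑x  | yes refl = contradiction a↑b ¬a↑x

  point-neg : ∀ a x → point a ℤ.-1ℤ x ≡ ℤ.- point a (+ 1) x
  point-neg a x with x ≟ a
  ... | yes _ = refl
  ... | no _  = refl

  moveFlow-balance : ∀ {a b} → Adjacent E a b → ∀ x →
                     childSum (moveFlow (a , b)) x ℤ.- moveFlow (a , b) x ≡ point b (+ 1) x ℤ.- point a (+ 1) x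
  moveFlow-balance {a} {b} ab x with ≡-decₘ _≟_ (parent a) (just b)
  ... | yes a↑b = cong (λ z → z ℤ.- point a (+ 1) x) (trans (childSum-point a (+ 1) x) (parent-point a↑b (+ 1) x))
  ... | no ¬a↑b with edge⇒parentEdge ab
  ...   | inj₁ a↑b = contradiction a↑b ¬a↑b
  ...   | inj₂ b↑a = begin
    childSum (point b ℤ.-1ℤ) x ℤ.- point b ℤ.-1ℤ x  ≡⟨ cong₂ ℤ._-_ (trans (childSum-point b ℤ.-1ℤ x) (parent-point b↑a ℤ.-1ℤ x)) (point-neg b x) ⟩
    point a ℤ.-1ℤ x ℤ.- ℤ.- point b (+ 1) x         ≡⟨ cong (λ p → p ℤ.- ℤ.- point b (+ 1) x) (point-neg a x) ⟩
    ℤ.- point a (+ 1) x ℤ.- ℤ.- point b (+ 1) x     ≡⟨ swap (point a (+ 1) x) (point b (+ 1) x) ⟩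
    point b (+ 1) x ℤ.- point a (+ 1) x             ∎
    where
    open ≡-Reasoning
    swap : ∀ p q → ℤ.- p ℤ.- ℤ.- q ≡ q ℤ.- p
    swap = ℤRing.solve-∀

  moveConf-balance : ∀ (c : Config n) {a b} → c a ≡ true → c b ≡ false → ∀ x →
                     b2z (moveConf c a b x) ℤ.- b2z (c x) ≡ point b (+ 1) x ℤ.- point a (+ 1) x
  moveConf-balance c {a} {b} ca cb x with x ≟ b | x ≟ a
  ... | yes refl | yes refl = contradiction (trans (sym ca) cb) λ ()
  ... | yes refl | no _     rewrite cb = refl
  ... | no _     | yes refl rewrite ca = refl
  ... | no _     | no _     = ℤₚ.+-inverseʳ (b2z (c x))

  flow-conservation : ∀ {tgt c P} → Reaches E tgt c P → ∀ x → b2z (tgt x) ℤ.- b2z (c x) ≡ childSum (flow P) x ℤ.- flow P x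
  flow-conservation {tgt} {c} (done c≡tgt) x = begin
    b2z (tgt x) ℤ.- b2z (c x)           ≡⟨ cong (λ cx → b2z (tgt x) ℤ.- b2z cx) (c≡tgt x) ⟩
    b2z (tgt x) ℤ.- b2z (tgt x)         ≡⟨ ℤₚ.+-inverseʳ (b2z (tgt x)) ⟩
    + 0                                 ≡⟨ cong (λ z → z ℤ.- + 0) (childSum-zero x) ⟨
    childSum (flow []) x ℤ.- flow [] x  ∎
    where open ≡-Reasoning
  flow-conservation {tgt} {c} {(a , b) ∷ P} (step ca cb ab reaches) x = begin
    b2z (tgt x) ℤ.- b2z (c x)                                    ≡⟨ split (b2z (tgt x)) (b2z (c′ x)) (b2z (c x)) ⟩
    (b2z (tgt x) ℤ.- b2z (c′ x)) ℤ.+ (b2z (c′ x) ℤ.- b2z (c x))  ≡⟨ cong₂ ℤ._+_ (flow-conservation reaches x) (moveConf-balance c ca cb x) ⟩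
    (childSum (flow P) x ℤ.- flow P x) ℤ.+ (point b (+ 1) x ℤ.- point a (+ 1) x)
                                                          ≡⟨ cong (λ δ → (childSum (flow P) x ℤ.- flow P x) ℤ.+ δ) (moveFlow-balance ab x) ⟨
    (childSum (flow P) x ℤ.- flow P x) ℤ.+ (childSum (moveFlow (a , b)) x ℤ.- moveFlow (a , b) x)
                                                          ≡⟨ regroup (childSum (flow P) x) (flow P x) (childSum (moveFlow (a , b)) x) (moveFlow (a , b) x) ⟩
    (childSum (moveFlow (a , b)) x ℤ.+ childSum (flow P) x) ℤ.- flow ((a , b) ∷ P) x
                                                          ≡⟨ cong (λ z → z ℤ.- flow ((a , b) ∷ P) x) (childSum-+ (moveFlow (a , b)) (flow P) x) ⟨
    childSum (flow ((a , b) ∷ P)) x ℤ.- flow ((a , b) ∷ P) x     ∎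
    where
    open ≡-Reasoning
    c′ = moveConf c a b
    split : ∀ t p q → t ℤ.- q ≡ (t ℤ.- p) ℤ.+ (p ℤ.- q)
    split = ℤRing.solve-∀
    regroup : ∀ s f s′ f′ → (s ℤ.- f) ℤ.+ (s′ ℤ.- f′) ≡ (s′ ℤ.+ s) ℤ.- (f′ ℤ.+ f)
    regroup = ℤRing.solve-∀

  ∣moveFlow∣ : ∀ m x → ∣ moveFlow m x ∣ ≤ (if does (x ≟ movedEdge m) then 1 else 0)
  ∣moveFlow∣ (a , b) x with isParent a b
  ... | true with x ≟ a
  ...   | yes _ = ≤-refl
  ...   | no _  = ≤-refl
  ∣moveFlow∣ (a , b) x | false with x ≟ b
  ...   | yes _ = ≤-refl
  ...   | no _  = z≤n

  ∣flow∣≤count : ∀ P x → ∣ flow P x ∣ ≤ count x (map movedEdge P)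
  ∣flow∣≤count []      x = z≤n
  ∣flow∣≤count (m ∷ P) x = ≤-trans (ℤₚ.∣i+j∣≤∣i∣+∣j∣ (moveFlow m x) (flow P x)) (+-mono-≤ (∣moveFlow∣ m x) (∣flow∣≤count P x))

  sum∣flow∣≤length : ∀ P → sum (λ x → ∣ flow P x ∣) ≤ length P
  sum∣flow∣≤length P = begin
    sum (λ x → ∣ flow P x ∣)               ≤⟨ sum-mono-≤ (∣flow∣≤count P) ⟩
    sum (λ x → count x (map movedEdge P))  ≡⟨ sum-count (map movedEdge P) ⟩
    length (map movedEdge P)               ≡⟨ length-map movedEdge P ⟩
    length P                               ∎
    where open ≤-Reasoning

  accumulate-demand≤length : ∀ {ord} → Unique ord → (∀ x → x ∈ ord) →
    (∀ {x p} → parent x ≡ just p → position ord x < position ord p) →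
    ∀ {tgt c P} → Reaches E tgt c P → (d : Fin n → ℤ) → (∀ x → d x ≡ b2z (tgt x) ℤ.- b2z (c x)) →
    sum (λ x → ∣ accumulate ord d x ∣) ≤ length P
  accumulate-demand≤length {ord} !ord ord-complete children-first {P = P} reaches d d≡ = begin
    sum (λ x → ∣ accumulate ord d x ∣)  ≡⟨ sum-cong-≗ (λ x → trans (cong ∣_∣ (accumulate≡-flow x)) (ℤₚ.∣-i∣≡∣i∣ (flow P x))) ⟩
    sum (λ x → ∣ flow P x ∣)            ≤⟨ sum∣flow∣≤length P ⟩
    length P                            ∎
    where
    open ≤-Reasoning
    accumulate≡-flow : ∀ x → accumulate ord d x ≡ ℤ.- flow P x
    accumulate≡-flow = accumulate-flow ord !ord ord-complete children-first (flow P) d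
      (λ x → trans (d≡ x) (flow-conservation reaches x))

module _ {n : ℕ} where
  open Algorithm n
  open St

  addEdge : Edge n → (Fin n → List (Fin n)) → Fin n → List (Fin n)
  addEdge (a , b) f = upd (upd f a (b ∷ f a)) b (a ∷ upd f a (b ∷ f a) b)

  addEdges : List (Edge n) → (Fin n → List (Fin n)) → Fin n → List (Fin n)
  addEdges []       f = f
  addEdges (e ∷ es) f = addEdges es (addEdge e f)

  markAll : List (Fin n) → (Fin n → Bool) → Fin n → Bool
  markAll []       f = f
  markAll (a ∷ as) f = markAll as (upd f a true)

  afterReadInput : List (Edge n) → List (Fin n) → List (Fin n) → St → St
  afterReadInput E A T s = record s
    { ticks   = 2 * length T + (2 * length A + (5 * length E + ticks s))
    ; adj     = addEdges E (adj s)
    ; agentA  = markAll A (agentA s)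
    ; targetA = markAll T (targetA s) }

  readEdges-effect : ∀ (body : Edge n → M ⊤) →
    (∀ a b s → proj₂ (body (a , b) s) ≡ record s { ticks = 4 + ticks s ; adj = addEdge (a , b) (adj s) }) →
    ∀ E s → proj₂ (forM_ E body s) ≡ record s { ticks = 5 * length E + ticks s ; adj = addEdges E (adj s) }
  readEdges-effect body body≡ []            s = refl
  readEdges-effect body body≡ ((a , b) ∷ E) s
    rewrite body≡ a b (record s { ticks = suc (ticks s) }) | readEdges-effect body body≡ E (record s { ticks = 4 + suc (ticks s) ; adj = addEdge (a , b) (adj s) })
    = cong (λ t → record s { ticks = t ; adj = addEdges E (addEdge (a , b) (adj s)) }) (ticks≡ (length E) (ticks s))
    where
    ticks≡ : ∀ L t → 5 * L + (4 + suc t) ≡ 5 * suc L + t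
    ticks≡ = solve-∀

  two-per-item : ∀ L t → 2 * L + suc (suc t) ≡ 2 * suc L + t
  two-per-item = solve-∀

  readAgents-effect : ∀ A s → proj₂ (forM_ A (λ a → setAgent a true) s) ≡ record s { ticks = 2 * length A + ticks s ; agentA = markAll A (agentA s) }
  readAgents-effect []       s = refl
  readAgents-effect (a ∷ as) s = trans (readAgents-effect as _)
    (cong (λ t → record s { ticks = t ; agentA = markAll as (upd (agentA s) a true) }) (two-per-item (length as) (ticks s)))

  readTargets-effect : ∀ T s → proj₂ (forM_ T (λ t → setTarget t true) s) ≡ record s { ticks = 2 * length T + ticks s ; targetA = markAll T (targetA s) }
  readTargets-effect []       s = refl
  readTargets-effect (a ∷ as) s = trans (readTargets-effect as _)
    (cong (λ t → record s { ticks = t ; targetA = markAll as (upd (targetA s) a true) }) (two-per-item (length as) (ticks s)))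

  readInput-effect : ∀ E A T s → proj₂ (readInput E A T s) ≡ afterReadInput E A T s
  readInput-effect E A T s = trans
    (cong (λ s₁ → proj₂ (forM_ T (λ t → setTarget t true) (proj₂ (forM_ A (λ a → setAgent a true) s₁))))
          (readEdges-effect _ (λ _ _ _ → refl) E s))
    (trans (cong (λ s₂ → proj₂ (forM_ T (λ t → setTarget t true) s₂)) (readAgents-effect A _)) (readTargets-effect T _))

  markAll≡mem∨ : ∀ A f x → markAll A f x ≡ mem A x ∨ f x
  markAll≡mem∨ []       f x = refl
  markAll≡mem∨ (a ∷ as) f x with markAll≡mem∨ as (upd f a true) x
  ... | ih with x ≟ a
  ...   | yes _ = trans ih (∨-zeroʳ (mem as x))
  ...   | no _  = ih

  markAll-mem : ∀ A x → markAll A (λ _ → false) x ≡ mem A x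
  markAll-mem A x = trans (markAll≡mem∨ A _ x) (∨-identityʳ (mem A x))

  ∈-upd⁻ : ∀ {A : Set} (f : Fin n → List A) u l x {w} → w ∈ upd f u l x → (x ≡ u × w ∈ l) ⊎ w ∈ f x
  ∈-upd⁻ f u l x w∈ with x ≟ u
  ... | yes x≡u = inj₁ (x≡u , w∈)
  ... | no _    = inj₂ w∈

  ∈-upd⁺ : ∀ {A : Set} (f : Fin n → List A) u l x {w} → w ∈ f x → (x ≡ u → w ∈ l) → w ∈ upd f u l x
  ∈-upd⁺ f u l x w∈f w∈l with x ≟ u
  ... | yes x≡u = w∈l x≡u
  ... | no _    = w∈f

  ∈-addEdge⁻ : ∀ a b f x {w} → w ∈ addEdge (a , b) f x → w ∈ f x ⊎ Adjacent ((a , b) ∷ []) x w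
  ∈-addEdge⁻ a b f x w∈ with ∈-upd⁻ (upd f a (b ∷ f a)) b (a ∷ upd f a (b ∷ f a) b) x w∈
  ... | inj₁ (refl , here refl)  = inj₂ (inj₂ (here refl))
  ... | inj₁ (refl , there w∈′) = first-update w∈′
    where
    first-update : ∀ {w} → w ∈ upd f a (b ∷ f a) x → w ∈ f x ⊎ Adjacent ((a , b) ∷ []) x w
    first-update w∈′ with ∈-upd⁻ f a (b ∷ f a) x w∈′
    ... | inj₁ (refl , here refl)   = inj₂ (inj₁ (here refl))
    ... | inj₁ (refl , there w∈f)  = inj₁ w∈f
    ... | inj₂ w∈f                 = inj₁ w∈f
  ... | inj₂ w∈′ with ∈-upd⁻ f a (b ∷ f a) x w∈′
  ...   | inj₁ (refl , here refl)  = inj₂ (inj₁ (here refl))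
  ...   | inj₁ (refl , there w∈f) = inj₁ w∈f
  ...   | inj₂ w∈f                = inj₁ w∈f

  ∈-addEdge⁺ : ∀ e f x {w} → w ∈ f x → w ∈ addEdge e f x
  ∈-addEdge⁺ (a , b) f x {w} w∈ = ∈-upd⁺ f₁ b (a ∷ f₁ b) x w∈f₁ (λ { refl → there w∈f₁ })
    where
    f₁ = upd f a (b ∷ f a)
    w∈f₁ : w ∈ f₁ x
    w∈f₁ = ∈-upd⁺ f a (b ∷ f a) x w∈ (λ { refl → there w∈ })

  addEdge-∋ˡ : ∀ a b f → b ∈ addEdge (a , b) f a
  addEdge-∋ˡ a b f = ∈-upd⁺ f₁ b (a ∷ f₁ b) a b∈f₁a (λ { refl → there b∈f₁a })
    where
    f₁ = upd f a (b ∷ f a)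
    b∈f₁a : b ∈ f₁ a
    b∈f₁a = subst (b ∈_) (sym (upd-≡ f a (b ∷ f a))) (here refl)

  addEdge-∋ʳ : ∀ a b f → a ∈ addEdge (a , b) f b
  addEdge-∋ʳ a b f = subst (a ∈_) (sym (upd-≡ (upd f a (b ∷ f a)) b _)) (here refl)

  ∈-addEdges⁺ : ∀ E f x {w} → w ∈ f x → w ∈ addEdges E f x
  ∈-addEdges⁺ []      f x w∈ = w∈
  ∈-addEdges⁺ (e ∷ E) f x w∈ = ∈-addEdges⁺ E _ x (∈-addEdge⁺ e f x w∈)

  adjacent⇒∈-addEdges : ∀ E f {x w} → Adjacent E x w → w ∈ addEdges E f x
  adjacent⇒∈-addEdges ((a , b) ∷ E) f (inj₁ (here refl))  = ∈-addEdges⁺ E _ a (addEdge-∋ˡ a b f)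
  adjacent⇒∈-addEdges ((a , b) ∷ E) f (inj₂ (here refl))  = ∈-addEdges⁺ E _ b (addEdge-∋ʳ a b f)
  adjacent⇒∈-addEdges (_ ∷ E)       f (inj₁ (there xw∈E)) = adjacent⇒∈-addEdges E _ (inj₁ xw∈E)
  adjacent⇒∈-addEdges (_ ∷ E)       f (inj₂ (there wx∈E)) = adjacent⇒∈-addEdges E _ (inj₂ wx∈E)

  ∈-addEdges⁻ : ∀ E f x {w} → w ∈ addEdges E f x → w ∈ f x ⊎ Adjacent E x w
  ∈-addEdges⁻ []      f x w∈ = inj₁ w∈
  ∈-addEdges⁻ (e ∷ E) f x w∈ with ∈-addEdges⁻ E (addEdge e f) x w∈
  ... | inj₂ (inj₁ xw∈E) = inj₂ (inj₁ (there xw∈E))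
  ... | inj₂ (inj₂ wx∈E) = inj₂ (inj₂ (there wx∈E))
  ... | inj₁ w∈′ with ∈-addEdge⁻ (proj₁ e) (proj₂ e) f x w∈′
  ...   | inj₁ w∈f                = inj₁ w∈f
  ...   | inj₂ (inj₁ (here xw≡e)) = inj₂ (inj₁ (here xw≡e))
  ...   | inj₂ (inj₂ (here wx≡e)) = inj₂ (inj₂ (here wx≡e))

  totalLength : (Fin n → List (Fin n)) → ℕ
  totalLength f = sum (λ x → length (f x))

  totalLength-cons : ∀ f u (y : Fin n) → totalLength (upd f u (y ∷ f u)) ≡ suc (totalLength f)
  totalLength-cons f u y = +-cancelʳ-≡ (length (f u)) _ _ (trans
    (sum-except (λ x → length (upd f u (y ∷ f u) x)) (λ x → length (f x)) u (λ x x≢u → cong length (upd-≢ f u (y ∷ f u) x≢u)))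
    (trans (cong (λ l → totalLength f + length l) (upd-≡ f u (y ∷ f u))) (+-suc (totalLength f) (length (f u)))))

  totalLength-addEdges : ∀ E f → totalLength (addEdges E f) ≡ 2 * length E + totalLength f
  totalLength-addEdges []            f = refl
  totalLength-addEdges ((a , b) ∷ E) f = trans (totalLength-addEdges E _) (trans (cong (λ z → 2 * length E + z)
    (trans (totalLength-cons (upd f a (b ∷ f a)) b a) (cong suc (totalLength-cons f a b)))) (two-per-item (length E) (totalLength f)))

module _ {n : ℕ} where
  open Algorithm n
  open St

  updAll : ∀ {A : Set} → List (Fin n) → (Fin n → A) → (Fin n → A) → Fin n → A
  updAll []       f g = f
  updAll (u ∷ us) f g = updAll us (upd f u (g u)) g

  updAll-∈ : ∀ {A : Set} us (f g : Fin n → A) {u} → u ∈ us → updAll us f g u ≡ g u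
  updAll-∈ (y ∷ ys) f g (here refl) = keep ys (upd-≡ f y (g y))
    where
    keep : ∀ us {f u} → f u ≡ g u → updAll us f g u ≡ g u
    keep []       fu≡gu = fu≡gu
    keep (y ∷ ys) {f} {u} fu≡gu = keep ys upd≡
      where
      upd≡ : upd f y (g y) u ≡ g u
      upd≡ with u ≟ y
      ... | yes refl = refl
      ... | no _     = fu≡gu
  updAll-∈ (y ∷ ys) f g (there u∈) = updAll-∈ ys _ g u∈

  ownDemand : St → Fin n → ℤ
  ownDemand s u = b2z (targetA s u) ℤ.- b2z (agentA s u)

  initPass-effect : ∀ ord s → proj₂ (initPass ord s) ≡ record s
    { ticks = 6 * length ord + ticks s
    ; dem   = updAll ord (dem s) (ownDemand s)
    ; pend  = updAll ord (pend s) (children s) }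
  initPass-effect []       s = refl
  initPass-effect (u ∷ us) s = trans (initPass-effect us _) (cong (λ t → record s
    { ticks = t ; dem = updAll us (upd (dem s) u (ownDemand s u)) (ownDemand s) ; pend = updAll us (upd (pend s) u (children s u)) (children s) })
    (six-ticks (length us) (ticks s)))
    where
    six-ticks : ∀ L t → 6 * L + (5 + suc t) ≡ 6 * suc L + t
    six-ticks = solve-∀

  pushUpCost : Maybe (Fin n) → ℕ
  pushUpCost nothing  = 3
  pushUpCost (just _) = 5

  accPassCost : (Fin n → Maybe (Fin n)) → List (Fin n) → ℕ
  accPassCost parent []       = 0
  accPassCost parent (u ∷ us) = pushUpCost (parent u) + accPassCost parent us

  accPassCost≤ : ∀ parent us → accPassCost parent us ≤ 5 * length us
  accPassCost≤ parent []       = z≤n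
  accPassCost≤ parent (u ∷ us) =
    ≤-trans (+-mono-≤ (pushUpCost≤5 (parent u)) (accPassCost≤ parent us)) (≤-reflexive (five-more (length us)))
    where
    five-more : ∀ L → 5 + 5 * L ≡ 5 * suc L
    five-more = solve-∀
    pushUpCost≤5 : ∀ p → pushUpCost p ≤ 5
    pushUpCost≤5 nothing  = s≤s (s≤s (s≤s z≤n))
    pushUpCost≤5 (just _) = ≤-refl

  accPass-effect : ∀ ord s → proj₂ (accPass ord s) ≡ record s
    { ticks = accPassCost (parent s) ord + ticks s
    ; dem   = Accumulation.accumulate (parent s) ord (dem s) }
  accPass-effect []       s = refl
  accPass-effect (u ∷ us) s with parent s u
  ... | nothing = trans (accPass-effect us _)
    (cong (λ t → record s { ticks = t ; dem = Accumulation.accumulate (parent s) us (dem s) }) (shift (accPassCost (parent s) us) (ticks s)))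
    where
    shift : ∀ c t → c + suc (suc (suc t)) ≡ 3 + c + t
    shift = solve-∀
  ... | just q = trans (accPass-effect us _)
    (cong (λ t → record s { ticks = t ; dem = Accumulation.accumulate (parent s) us (upd (dem s) q (dem s q ℤ.+ dem s u)) })
      (shift (accPassCost (parent s) us) (ticks s)))
    where
    shift : ∀ c t → c + suc (suc (suc (suc (suc t)))) ≡ 5 + c + t
    shift = solve-∀

-- Rooting the tree by depth-first search

module Dfs {n : ℕ} (r : Fin n) (nbrs : Fin n → List (Fin n)) where
  open Algorithm n
  open St

  visitCost : Fin n → ℕ
  visitCost x = 2 + 6 * length (nbrs x)

  stackCost : List (Fin n) → ℕ
  stackCost []       = 0
  stackCost (x ∷ xs) = visitCost x + stackCost xs

  unvisitedCost : St → Fin n → ℕ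
  unvisitedCost s x = if visited s x then 0 else visitCost x

  -- Every node that is unvisited or still on the stack has yet to pay for its pop and its neighbour scan.
  potential : St → List (Fin n) → ℕ
  potential s stack = sum (unvisitedCost s) + stackCost stack

  record Invariant (s : St) (stack popped : List (Fin n)) (Expanded : Fin n → Set) : Set where
    field
      adj≡                  : ∀ x → adj s x ≡ nbrs x
      root-visited          : visited s r ≡ true
      visited⇒seen          : ∀ {x} → visited s x ≡ true → x ∈ stack ⊎ x ∈ popped
      stacked⇒visited       : ∀ {x} → x ∈ stack → visited s x ≡ true
      popped⇒visited        : ∀ {x} → x ∈ popped → visited s x ≡ true
      stack-unique          : Unique stack
      popped-unique         : Unique popped
      stack-popped-disjoint : ∀ {x} → x ∈ stack → x ∉ popped
      expanded-nbrs-visited : ∀ {x} → Expanded x → ∀ {w} → w ∈ nbrs x → visited s w ≡ true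
      unvisited⇒no-parent   : ∀ {x} → visited s x ≡ false → parent s x ≡ nothing
      visited⇒has-parent    : ∀ {x} → visited s x ≡ true → x ≢ r → ∃ λ p → parent s x ≡ just p
      parent-nbr            : ∀ {x p} → parent s x ≡ just p → x ∈ nbrs p
      stacked-parent-popped : ∀ {x p} → x ∈ stack → parent s x ≡ just p → p ∈ popped
      popped-parent-later   : ∀ {x p} → x ∈ popped → parent s x ≡ just p → p ∈ popped × position popped x < position popped p
      children⇒parent       : ∀ {x y} → y ∈ children s x → parent s y ≡ just x
      children-unique       : ∀ x → Unique (children s x)

  DfsFieldsOnly : St → St → Set
  DfsFieldsOnly s s′ = s′ ≡ record s { ticks = ticks s′ ; visited = visited s′ ; parent = parent s′ ; children = children s′ }

  DfsFieldsOnly-trans : ∀ {s₁ s₂ s₃} → DfsFieldsOnly s₁ s₂ → DfsFieldsOnly s₂ s₃ → DfsFieldsOnly s₁ s₃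
  DfsFieldsOnly-trans {s₃ = s₃} s₁₂ s₂₃ =
    trans s₂₃ (cong (λ s → record s { ticks = ticks s₃ ; visited = visited s₃ ; parent = parent s₃ ; children = children s₃ }) s₁₂)

  push : St → Fin n → Fin n → St
  push s u w = record s
    { ticks    = 6 + ticks s
    ; visited  = upd (visited s) w true
    ; parent   = upd (parent s) w (just u)
    ; children = upd (children s) u (w ∷ children s u) }

  push-visited : ∀ s u w {x} → visited s x ≡ true → visited (push s u w) x ≡ true
  push-visited s u w {x} vx = by-cases-≟ x w (λ { refl → upd-≡ (visited s) w true }) (λ x≢w → trans (upd-≢ (visited s) w true x≢w) vx)

  push-invariant : ∀ {s u w stack popped Expanded} → Invariant s stack (u ∷ popped) Expanded → visited s w ≡ false → w ∈ nbrs u →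
                   Invariant (push s u w) (w ∷ stack) (u ∷ popped) Expanded
  push-invariant {s} {u} {w} {stack} {popped} I w-unvisited w∈nbrs = record
    { adj≡         = adj≡
    ; root-visited = push-visited s u w root-visited
    ; visited⇒seen = λ {x} vx → by-cases-≟ x w (λ { refl → inj₁ (here refl) })
                                (λ x≢w → Sum.map₁ there (visited⇒seen (trans (sym (upd-≢ (visited s) w true x≢w)) vx)))
    ; stacked⇒visited       = λ { (here refl) → upd-≡ (visited s) w true ; (there x∈) → push-visited s u w (stacked⇒visited x∈) }
    ; popped⇒visited        = λ x∈ → push-visited s u w (popped⇒visited x∈)
    ; stack-unique          = ¬Any⇒All¬ stack (λ w∈ → fresh (stacked⇒visited w∈)) ∷ stack-unique
    ; popped-unique         = popped-unique
    ; stack-popped-disjoint = λ { (here refl) w∈popped → fresh (popped⇒visited w∈popped) ; (there x∈) → stack-popped-disjoint x∈ }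
    ; expanded-nbrs-visited = λ ex w∈ → push-visited s u w (expanded-nbrs-visited ex w∈)
    ; unvisited⇒no-parent   = λ {x} ux → by-cases-≟ x w
                                (λ { refl → contradiction (trans (sym (upd-≡ (visited s) w true)) ux) λ () })
                                (λ x≢w → trans (upd-≢ (parent s) w (just u) x≢w) (unvisited⇒no-parent (trans (sym (upd-≢ (visited s) w true x≢w)) ux)))
    ; visited⇒has-parent    = λ {x} vx x≢r → by-cases-≟ x w (λ { refl → u , upd-≡ (parent s) w (just u) })
                                (λ x≢w → subst (λ p → ∃ λ q → p ≡ just q) (sym (upd-≢ (parent s) w (just u) x≢w))
                                           (visited⇒has-parent (trans (sym (upd-≢ (visited s) w true x≢w)) vx) x≢r))
    ; parent-nbr            = λ {x} x↑p → by-cases-≟ x w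
                                (λ { refl → subst (λ q → w ∈ nbrs q) (just-injective (trans (sym (upd-≡ (parent s) w (just u))) x↑p)) w∈nbrs })
                                (λ x≢w → parent-nbr (trans (sym (upd-≢ (parent s) w (just u) x≢w)) x↑p))
    ; stacked-parent-popped   = λ { (here refl) w↑p → subst (_∈ u ∷ popped) (just-injective (trans (sym (upd-≡ (parent s) w (just u))) w↑p)) (here refl)
                                ; (there x∈) x↑p → stacked-parent-popped x∈ (trans (sym (upd-≢ (parent s) w (just u) (stacked≢w x∈))) x↑p) }
    ; popped-parent-later = λ x∈ x↑p → popped-parent-later x∈ (trans (sym (upd-≢ (parent s) w (just u) (popped≢w x∈))) x↑p)
    ; children⇒parent     = children⇒parent′
    ; children-unique     = children-unique′ }
    where
    open Invariant I
    fresh : visited s w ≡ true → ⊥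
    fresh vw = contradiction (trans (sym vw) w-unvisited) λ ()
    stacked≢w : ∀ {x} → x ∈ stack → x ≢ w
    stacked≢w x∈ refl = fresh (stacked⇒visited x∈)
    popped≢w : ∀ {x} → x ∈ u ∷ popped → x ≢ w
    popped≢w x∈ refl = fresh (popped⇒visited x∈)
    orphan : ∀ {x} → w ∉ children s x
    orphan w∈ = contradiction (trans (sym (unvisited⇒no-parent w-unvisited)) (children⇒parent w∈)) λ ()
    child≢w : ∀ {x y} → y ∈ children s x → y ≢ w
    child≢w y∈ refl = orphan y∈
    children⇒parent′ : ∀ {x y} → y ∈ children (push s u w) x → parent (push s u w) y ≡ just x
    children⇒parent′ {x} {y} y∈ = by-cases-≟ x u
      (λ { refl → new-child (subst (y ∈_) (upd-≡ (children s) u _) y∈) })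
      (λ x≢u → old-child (subst (y ∈_) (upd-≢ (children s) u _ x≢u) y∈))
      where
      old-child : ∀ {x} → y ∈ children s x → parent (push s u w) y ≡ just x
      old-child y∈ = trans (upd-≢ (parent s) w (just u) (child≢w y∈)) (children⇒parent y∈)
      new-child : y ∈ w ∷ children s u → parent (push s u w) y ≡ just u
      new-child (here refl) = upd-≡ (parent s) w (just u)
      new-child (there y∈)  = old-child y∈
    children-unique′ : ∀ x → Unique (children (push s u w) x)
    children-unique′ x = by-cases-≟ x u
      (λ { refl → subst Unique (sym (upd-≡ (children s) u _)) (¬Any⇒All¬ (children s u) orphan ∷ children-unique u) })
      (λ x≢u → subst Unique (sym (upd-≢ (children s) u _ x≢u)) (children-unique x))

  potential-push : ∀ s u w stack → visited s w ≡ false → potential (push s u w) (w ∷ stack) ≡ potential s stack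
  potential-push s u w stack w-unvisited = begin
    sum c′ + (visitCost w + stackCost stack)   ≡⟨ +-assoc (sum c′) (visitCost w) (stackCost stack) ⟨
    sum c′ + visitCost w + stackCost stack     ≡⟨ cong (λ c → sum c′ + c + stackCost stack) (cong (λ b → if b then 0 else visitCost w) w-unvisited) ⟨
    sum c′ + unvisitedCost s w + stackCost stack ≡⟨ cong (_+ stackCost stack) (sum-except c′ (unvisitedCost s) w
                                                      (λ x x≢w → cong (λ b → if b then 0 else visitCost x) (upd-≢ (visited s) w true x≢w))) ⟩
    sum (unvisitedCost s) + c′ w + stackCost stack ≡⟨ cong (λ c → sum (unvisitedCost s) + c + stackCost stack)
                                                      (cong (λ b → if b then 0 else visitCost w) (upd-≡ (visited s) w true)) ⟩
    sum (unvisitedCost s) + 0 + stackCost stack ≡⟨ cong (_+ stackCost stack) (+-identityʳ _) ⟩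
    potential s stack                           ∎
    where
    open ≡-Reasoning
    c′ = unvisitedCost (push s u w)

  Invariant-ticks : ∀ {s stack popped Expanded} t → Invariant s stack popped Expanded → Invariant (record s { ticks = t }) stack popped Expanded
  Invariant-ticks t I = record { Invariant I }

  record ScanResult (u : Fin n) (popped ws stack : List (Fin n)) (s : St) (stack′ : List (Fin n)) (s′ : St) : Set where
    field
      invariant    : Invariant s′ stack′ (u ∷ popped) (_∈ popped)
      nbrs-visited : ∀ {w} → w ∈ nbrs u → visited s′ w ≡ true
      cost         : ticks s′ + potential s′ stack′ ≤ ticks s + potential s stack + 6 * length ws
      fields-only  : DfsFieldsOnly s s′

  visitNbrs-spec : ∀ {u popped} ws stack s → Invariant s stack (u ∷ popped) (_∈ popped) →
    (∀ {w} → w ∈ ws → w ∈ nbrs u) → (∀ {w} → w ∈ nbrs u → visited s w ≡ true ⊎ w ∈ ws) →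
    ScanResult u popped ws stack s (proj₁ (visitNbrs u ws stack s)) (proj₂ (visitNbrs u ws stack s))
  visitNbrs-spec [] stack s I _ scanned = record
    { invariant    = I
    ; nbrs-visited = λ w∈ → Sum.[ (λ vw → vw) , (λ ()) ] (scanned w∈)
    ; cost         = m≤m+n _ 0
    ; fields-only  = refl }
  visitNbrs-spec {u} (w ∷ ws) stack s I ws⊆ scanned with visited s w in vw
  ... | true = record
    { invariant    = ScanResult.invariant rest
    ; nbrs-visited = ScanResult.nbrs-visited rest
    ; cost         = ≤-trans (ScanResult.cost rest) (≤-trans (≤-reflexive (regroup (ticks s) (potential s stack) (length ws)))
                       (+-monoʳ-≤ (ticks s + potential s stack) (≤-trans (+-monoˡ-≤ (6 * length ws) (m≤m+n 2 4)) (≤-reflexive (six-more (length ws))))))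
    ; fields-only  = DfsFieldsOnly-trans {s} {s₁} refl (ScanResult.fields-only rest) }
    where
    s₁ = record s { ticks = suc (suc (ticks s)) }
    rest = visitNbrs-spec ws stack s₁ (Invariant-ticks _ I) (λ w∈ → ws⊆ (there w∈)) λ w′∈ → case (scanned w′∈)
      where
      case : ∀ {w′} → visited s w′ ≡ true ⊎ w′ ∈ w ∷ ws → visited s w′ ≡ true ⊎ w′ ∈ ws
      case (inj₁ vw′)        = inj₁ vw′
      case (inj₂ (here refl)) = inj₁ vw
      case (inj₂ (there w′∈)) = inj₂ w′∈
    regroup : ∀ t p L → suc (suc t) + p + 6 * L ≡ t + p + (2 + 6 * L)
    regroup = solve-∀
    six-more : ∀ L → 6 + 6 * L ≡ 6 * suc L
    six-more = solve-∀
  ... | false = record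
    { invariant    = ScanResult.invariant rest
    ; nbrs-visited = ScanResult.nbrs-visited rest
    ; cost         = ≤-trans (ScanResult.cost rest) (≤-reflexive (trans
                       (cong (λ p → 6 + ticks s + p + 6 * length ws) (potential-push s u w stack vw))
                       (regroup (ticks s) (potential s stack) (length ws))))
    ; fields-only  = DfsFieldsOnly-trans {s} {s₁} refl (ScanResult.fields-only rest) }
    where
    s₁ = push s u w
    rest = visitNbrs-spec ws (w ∷ stack) s₁ (push-invariant I vw (ws⊆ (here refl))) (λ w∈ → ws⊆ (there w∈)) λ w′∈ → case (scanned w′∈)
      where
      case : ∀ {w′} → visited s w′ ≡ true ⊎ w′ ∈ w ∷ ws → visited s₁ w′ ≡ true ⊎ w′ ∈ ws
      case (inj₁ vw′)         = inj₁ (push-visited s u w vw′)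
      case (inj₂ (here refl)) = inj₁ (upd-≡ (visited s) w true)
      case (inj₂ (there w′∈)) = inj₂ w′∈
    regroup : ∀ t p L → 6 + t + p + 6 * L ≡ t + p + 6 * suc L
    regroup = solve-∀

  pop-invariant : ∀ {s u stack popped} → Invariant s (u ∷ stack) popped (_∈ popped) → Invariant s stack (u ∷ popped) (_∈ popped)
  pop-invariant {s} {u} {stack} {popped} I = record
    { Invariant I
    ; visited⇒seen          = λ vx → moved (visited⇒seen vx)
    ; stacked⇒visited       = λ x∈ → stacked⇒visited (there x∈)
    ; popped⇒visited        = λ { (here refl) → stacked⇒visited (here refl) ; (there x∈) → popped⇒visited x∈ }
    ; stack-unique          = tail stack-unique
    ; popped-unique         = ¬Any⇒All¬ popped u∉popped ∷ popped-unique
    ; stack-popped-disjoint = λ { x∈ (here refl) → All¬⇒¬Any (head stack-unique) x∈ ; x∈ (there x∈′) → stack-popped-disjoint (there x∈) x∈′ }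
    ; stacked-parent-popped = λ x∈ x↑p → there (stacked-parent-popped (there x∈) x↑p)
    ; popped-parent-later   = later }
    where
    open Invariant I
    u∉popped : u ∉ popped
    u∉popped = stack-popped-disjoint (here refl)
    moved : ∀ {x} → x ∈ u ∷ stack ⊎ x ∈ popped → x ∈ stack ⊎ x ∈ u ∷ popped
    moved (inj₁ (here refl)) = inj₂ (here refl)
    moved (inj₁ (there x∈))  = inj₁ x∈
    moved (inj₂ x∈)          = inj₂ (there x∈)
    popped≢u : ∀ {x} → x ∈ popped → x ≢ u
    popped≢u x∈ refl = u∉popped x∈
    later : ∀ {x p} → x ∈ u ∷ popped → parent s x ≡ just p → p ∈ u ∷ popped × position (u ∷ popped) x < position (u ∷ popped) p
    later (here refl) u↑p = there p∈ , subst₂ _<_ (sym (position-head u popped)) (sym (position-tail popped (popped≢u p∈))) (s≤s z≤n)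
      where p∈ = stacked-parent-popped (here refl) u↑p
    later (there x∈) x↑p with popped-parent-later x∈ x↑p
    ... | p∈ , x<p = there p∈ , subst₂ _<_ (sym (position-tail popped (popped≢u x∈))) (sym (position-tail popped (popped≢u p∈))) (s≤s x<p)

  expand-invariant : ∀ {s u stack popped} → Invariant s stack (u ∷ popped) (_∈ popped) → (∀ {w} → w ∈ nbrs u → visited s w ≡ true) →
                     Invariant s stack (u ∷ popped) (_∈ u ∷ popped)
  expand-invariant I u-expanded = record { Invariant I
    ; expanded-nbrs-visited = λ { (here refl) → u-expanded ; (there x∈) → Invariant.expanded-nbrs-visited I x∈ } }

  record DfsResult (stack : List (Fin n)) (s : St) (order : List (Fin n)) (s′ : St) : Set where
    field
      invariant   : Invariant s′ [] order (_∈ order)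
      cost        : ticks s′ ≤ ticks s + potential s stack
      fields-only : DfsFieldsOnly s s′

  dfs-spec : ∀ fuel stack popped s → Invariant s stack popped (_∈ popped) → length popped + fuel ≡ suc n →
             DfsResult stack s (proj₁ (dfs fuel stack popped s)) (proj₂ (dfs fuel stack popped s))
  dfs-spec zero stack popped s I |popped|≡ =
    contradiction (≤-trans (≤-reflexive (trans (sym |popped|≡) (+-identityʳ _))) (length-unique (Invariant.popped-unique I))) 1+n≰n
  dfs-spec (suc fuel) []          popped s I _ = record { invariant = I ; cost = m≤m+n _ _ ; fields-only = refl }
  dfs-spec (suc fuel) (u ∷ stack) popped s I |popped|≡ = record
    { invariant = DfsResult.invariant rest
    ; cost      = ≤-trans (DfsResult.cost rest) (≤-trans (ScanResult.cost scanned) (≤-reflexive (begin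
        suc (suc (ticks s)) + potential s stack + 6 * length (adj s u)  ≡⟨ cong (λ ns → suc (suc (ticks s)) + potential s stack + 6 * length ns) (adj≡ u) ⟩
        suc (suc (ticks s)) + potential s stack + 6 * length (nbrs u)   ≡⟨ regroup (ticks s) (sum (unvisitedCost s)) (stackCost stack) (length (nbrs u)) ⟩
        ticks s + potential s (u ∷ stack)                              ∎)))
    ; fields-only = DfsFieldsOnly-trans {s} {s₂} (DfsFieldsOnly-trans {s} {s₁} refl (ScanResult.fields-only scanned)) (DfsResult.fields-only rest) }
    where
    open Invariant I
    open ≡-Reasoning
    s₁ = record s { ticks = suc (suc (ticks s)) }
    scanned = visitNbrs-spec (adj s u) stack s₁ (Invariant-ticks _ (pop-invariant I))
             (λ w∈ → subst (_ ∈_) (adj≡ u) w∈) (λ w∈ → inj₂ (subst (_ ∈_) (sym (adj≡ u)) w∈))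
    stack′ = proj₁ (visitNbrs u (adj s u) stack s₁)
    s₂ = proj₂ (visitNbrs u (adj s u) stack s₁)
    rest = dfs-spec fuel stack′ (u ∷ popped) s₂ (expand-invariant (ScanResult.invariant scanned) (ScanResult.nbrs-visited scanned))
             (trans (sym (+-suc (length popped) fuel)) |popped|≡)
    regroup : ∀ t a b L → suc (suc t) + (a + b) + 6 * L ≡ t + (a + (2 + 6 * L + b))
    regroup = solve-∀

  initial-invariant : ∀ s → (∀ x → adj s x ≡ nbrs x) → (∀ x → visited s x ≡ false) → (∀ x → parent s x ≡ nothing) →
                      (∀ x → children s x ≡ []) →
                      Invariant (record s { ticks = suc (ticks s) ; visited = upd (visited s) r true }) [ r ] [] (_∈ [])
  initial-invariant s adj≡ unvisited orphans childless = record
    { adj≡                  = adj≡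
    ; root-visited          = upd-≡ (visited s) r true
    ; visited⇒seen          = λ {x} vx → by-cases-≟ x r (λ { refl → inj₁ (here refl) }) (λ x≢r → contradiction (only-root vx x≢r) λ ())
    ; stacked⇒visited       = λ { (here refl) → upd-≡ (visited s) r true }
    ; popped⇒visited        = λ ()
    ; stack-unique          = [] ∷ []
    ; popped-unique         = []
    ; stack-popped-disjoint = λ _ ()
    ; expanded-nbrs-visited = λ ()
    ; unvisited⇒no-parent   = λ _ → orphans _
    ; visited⇒has-parent    = λ vx x≢r → contradiction (only-root vx x≢r) λ ()
    ; parent-nbr            = λ x↑p → contradiction (trans (sym (orphans _)) x↑p) λ ()
    ; stacked-parent-popped = λ _ x↑p → contradiction (trans (sym (orphans _)) x↑p) λ ()
    ; popped-parent-later   = λ ()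
    ; children⇒parent       = λ {x} y∈ → contradiction (subst (_ ∈_) (childless x) y∈) λ ()
    ; children-unique       = λ x → subst Unique (sym (childless x)) [] }
    where
    only-root : ∀ {x} → upd (visited s) r true x ≡ true → x ≢ r → true ≡ false
    only-root vx x≢r = trans (sym vx) (trans (upd-≢ (visited s) r true x≢r) (unvisited _))

  initial-potential : ∀ s → (∀ x → visited s x ≡ false) → potential (record s { visited = upd (visited s) r true }) [ r ] ≡ sum visitCost
  initial-potential s unvisited = begin
    sum c′ + (visitCost r + 0)  ≡⟨ cong (λ z → sum c′ + z) (+-identityʳ (visitCost r)) ⟩
    sum c′ + visitCost r        ≡⟨ sum-except c′ visitCost r (λ x x≢r → cong (λ b → if b then 0 else visitCost x) (trans (upd-≢ (visited s) r true x≢r) (unvisited x))) ⟩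
    sum visitCost + c′ r        ≡⟨ cong (λ b → sum visitCost + (if b then 0 else visitCost r)) (upd-≡ (visited s) r true) ⟩
    sum visitCost + 0           ≡⟨ +-identityʳ _ ⟩
    sum visitCost               ∎
    where
    open ≡-Reasoning
    c′ = unvisitedCost (record s { visited = upd (visited s) r true })

  reachable⇒popped : ∀ {E : List (Edge n)} {s order} → Invariant s [] order (_∈ order) → (∀ {x w} → Adjacent E x w → w ∈ nbrs x) →
                     ∀ {x w} → Connected E x w → x ∈ order → w ∈ order
  reachable⇒popped I nbrs⊇E here                x∈ = x∈
  reachable⇒popped I nbrs⊇E (there xv connected) x∈ with Invariant.visited⇒seen I (Invariant.expanded-nbrs-visited I x∈ (nbrs⊇E xv))
  ... | inj₂ v∈ = reachable⇒popped I nbrs⊇E connected v∈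

-- Amortized analysis of process_subtree

bit : Bool → ℕ
bit true  = 1
bit false = 0

module ProcessSubtree {n : ℕ} where
  open Algorithm n
  open St

  setupCost : Bool → List (Fin n) → ℕ
  setupCost agent cs = 11 * bit agent + 4 + 7 * length cs

  -- Each unit of |d(u)| pays for the send_agent that resolves it and for the list entry it creates (6 per entry,
  -- one send_agent call each); each pending child pays for being skipped once by the scan in send_agent; and
  -- setupCost pays for prepending s(u) to l(u) and for the fixed and per-child work of process_subtree(u).
  nodePotential : ℤ → List (Fin n) → Bool → List ℕ → Bool → List (Fin n) → ℕ
  nodePotential d pending processed? l agent cs =
    18 * ∣ d ∣ + 2 * length pending + (if processed? then 0 else 6 * length l + setupCost agent cs)

  φ : St → Fin n → ℕ
  φ s x = nodePotential (dem s x) (pend s x) (processed s x) (lst s x) (agentA s x) (children s x)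

  Φ : St → ℕ
  Φ s = sum (φ s)

  Φ⁺ : St → ℕ
  Φ⁺ s = ticks s + Φ s

  withList : St → Fin n → List ℕ → St
  withList s u l = record s { lst = upd (lst s) u l }

  Φ-withList : ∀ s u l {k} → length l ≤ length (lst s u) + k → Φ (withList s u l) ≤ Φ s + 6 * k
  Φ-withList s u l {k} |l|≤ = sum-except-≤ (φ (withList s u l)) (φ s) u
    (λ x x≢u → cong (λ l → nodePotential (dem s x) (pend s x) (processed s x) l (agentA s x) (children s x)) (upd-≢ (lst s) u l x≢u))
    (subst (λ l′ → nodePotential (dem s u) (pend s u) (processed s u) l′ (agentA s u) (children s u) ≤ φ s u + 6 * k)
      (sym (upd-≡ (lst s) u l)) (grows (processed s u)))
    where
    grows : ∀ p → nodePotential (dem s u) (pend s u) p l (agentA s u) (children s u) ≤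
                     nodePotential (dem s u) (pend s u) p (lst s u) (agentA s u) (children s u) + 6 * k
    grows true  = m≤m+n _ _
    grows false = begin
      D + (6 * length l + W)               ≤⟨ +-monoʳ-≤ D (+-monoˡ-≤ W (*-monoʳ-≤ 6 |l|≤)) ⟩
      D + (6 * (length (lst s u) + k) + W) ≡⟨ regroup D (length (lst s u)) k W ⟩
      D + (6 * length (lst s u) + W) + 6 * k ∎
      where
      open ≤-Reasoning
      D = 18 * ∣ dem s u ∣ + 2 * length (pend s u)
      W = setupCost (agentA s u) (children s u)
      regroup : ∀ a L k W → a + (6 * (L + k) + W) ≡ a + (6 * L + W) + 6 * k
      regroup = solve-∀

  withDemand : St → Fin n → ℤ → St
  withDemand s u z = record s { dem = upd (dem s) u z }

  Φ-withDemand : ∀ s u z → ∣ z ∣ + 1 ≡ ∣ dem s u ∣ → Φ (withDemand s u z) + 18 ≤ Φ s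
  Φ-withDemand s u z |z|+1≡ = sum-except-+≤ (φ (withDemand s u z)) (φ s) u
    (λ x x≢u → cong (λ d → nodePotential d (pend s x) (processed s x) (lst s x) (agentA s x) (children s x)) (upd-≢ (dem s) u z x≢u))
    (subst (λ d → nodePotential d (pend s u) (processed s u) (lst s u) (agentA s u) (children s u) + 18 ≤ φ s u)
      (sym (upd-≡ (dem s) u z)) (≤-reflexive (begin
        18 * ∣ z ∣ + P + R + 18    ≡⟨ regroup (∣ z ∣) P R ⟩
        18 * (∣ z ∣ + 1) + P + R   ≡⟨ cong (λ a → 18 * a + P + R) |z|+1≡ ⟩
        18 * ∣ dem s u ∣ + P + R   ∎)))
    where
    open ≡-Reasoning
    P = 2 * length (pend s u)
    R = if processed s u then 0 else 6 * length (lst s u) + setupCost (agentA s u) (children s u)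
    regroup : ∀ a P R → 18 * a + P + R + 18 ≡ 18 * (a + 1) + P + R
    regroup = solve-∀

  withPending : St → Fin n → List (Fin n) → St
  withPending s u p = record s { pend = upd (pend s) u p }

  Φ-withPending : ∀ s u p → Φ (withPending s u p) + 2 * length (pend s u) ≡ Φ s + 2 * length p
  Φ-withPending s u p = sum-except-≡ (φ (withPending s u p)) (φ s) u
    (λ x x≢u → cong (λ q → nodePotential (dem s x) q (processed s x) (lst s x) (agentA s x) (children s x)) (upd-≢ (pend s) u p x≢u))
    (begin
      φ (withPending s u p) u + 2 * length (pend s u)  ≡⟨ cong (λ q → nodePotential (dem s u) q (processed s u) (lst s u) (agentA s u) (children s u) + 2 * length (pend s u)) (upd-≡ (pend s) u p) ⟩
      D + 2 * length p + R + 2 * length (pend s u) ≡⟨ swap D (2 * length p) R (2 * length (pend s u)) ⟩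
      D + 2 * length (pend s u) + R + 2 * length p ∎)
    where
    open ≡-Reasoning
    D = 18 * ∣ dem s u ∣
    R = if processed s u then 0 else 6 * length (lst s u) + setupCost (agentA s u) (children s u)
    swap : ∀ d p r q → d + p + r + q ≡ d + q + r + p
    swap = solve-∀

  withProcessed : St → Fin n → St
  withProcessed s u = record s { processed = upd (processed s) u true }

  Φ-withProcessed : ∀ s u → processed s u ≡ false →
                   Φ (withProcessed s u) + (6 * length (lst s u) + setupCost (agentA s u) (children s u)) ≡ Φ s
  Φ-withProcessed s u unprocessed = trans (sum-except-≡ (φ (withProcessed s u)) (φ s) u
    (λ x x≢u → cong (λ b → nodePotential (dem s x) (pend s x) b (lst s x) (agentA s x) (children s x)) (upd-≢ (processed s) u true x≢u))
    (begin
      φ (withProcessed s u) u + R  ≡⟨ cong (λ b → nodePotential (dem s u) (pend s u) b (lst s u) (agentA s u) (children s u) + R) (upd-≡ (processed s) u true) ⟩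
      D + 0 + R                    ≡⟨ cong (_+ R) (+-identityʳ D) ⟩
      D + R                        ≡⟨ +-identityʳ (D + R) ⟨
      D + R + 0                    ≡⟨ cong (λ b → nodePotential (dem s u) (pend s u) b (lst s u) (agentA s u) (children s u) + 0) unprocessed ⟨
      φ s u + 0                    ∎))
    (+-identityʳ (Φ s))
    where
    open ≡-Reasoning
    D = 18 * ∣ dem s u ∣ + 2 * length (pend s u)
    R = 6 * length (lst s u) + setupCost (agentA s u) (children s u)

  ∣z+1∣+1 : ∀ z → isNeg z ≡ true → ∣ z ℤ.+ + 1 ∣ + 1 ≡ ∣ z ∣
  ∣z+1∣+1 -[1+ zero ]  _ = refl
  ∣z+1∣+1 -[1+ suc k ] _ = cong suc (+-comm k 1)

  ∣z-1∣+1 : ∀ z → isPos z ≡ true → ∣ z ℤ.- + 1 ∣ + 1 ≡ ∣ z ∣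
  ∣z-1∣+1 (+ suc zero)    _ = refl
  ∣z-1∣+1 (+ suc (suc k)) _ = +-comm (suc k) 1

  record Amortized (k : ℕ) (s s′ : St) : Set where
    field
      children≡  : children s′ ≡ children s
      agents≡    : agentA s′ ≡ agentA s
      processed≡ : processed s′ ≡ processed s
      lists-grow : ∀ x → length (lst s x) ≤ length (lst s′ x)
      cost       : Φ⁺ s′ ≤ Φ⁺ s + k

  Amortized-trans : ∀ {j k s₁ s₂ s₃} → Amortized j s₁ s₂ → Amortized k s₂ s₃ → Amortized (j + k) s₁ s₃
  Amortized-trans {j} {k} {s₁} A₁₂ A₂₃ = record
    { children≡  = trans (children≡ A₂₃) (children≡ A₁₂)
    ; agents≡    = trans (agents≡ A₂₃) (agents≡ A₁₂)
    ; processed≡ = trans (processed≡ A₂₃) (processed≡ A₁₂)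
    ; lists-grow = λ x → ≤-trans (lists-grow A₁₂ x) (lists-grow A₂₃ x)
    ; cost       = ≤-trans (cost A₂₃) (≤-trans (+-monoˡ-≤ k (cost A₁₂)) (≤-reflexive (+-assoc (Φ⁺ s₁) j k))) }
    where open Amortized

  ticks-Amortized : ∀ s k → Amortized k s (record s { ticks = k + ticks s })
  ticks-Amortized s k = record { children≡ = refl ; agents≡ = refl ; processed≡ = refl ; lists-grow = λ _ → ≤-refl
                               ; cost = ≤-reflexive (regroup k (ticks s) (Φ s)) }
    where
    regroup : ∀ k t p → k + t + p ≡ t + p + k
    regroup = solve-∀

  appended-grows : ∀ (f : Fin n → List ℕ) q (y : ℕ) x → length (f x) ≤ length (upd f q (f q ++ [ y ]) x)
  appended-grows f q y x with x ≟ q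
  ... | yes refl = ≤-trans (m≤m+n _ 1) (≤-reflexive (sym (length-++ (f x))))
  ... | no _     = ≤-refl

  prepended-grows : ∀ (f : Fin n → List ℕ) q (y : ℕ) x → length (f x) ≤ length (upd f q (y ∷ f q) x)
  prepended-grows f q y x with x ≟ q
  ... | yes refl = m≤n+m _ 1
  ... | no _     = ≤-refl

  scan-spec : ∀ vs s → Σ ℕ λ k → (proj₂ (scan vs s) ≡ record s { ticks = k + ticks s }) ×
              (k + 2 * length (proj₂ (proj₁ (scan vs s))) ≤ 2 * length vs + 2) ×
              (∀ {v} → proj₁ (proj₁ (scan vs s)) ≡ just v → isPos (dem s v) ≡ true)
  scan-spec []       s = 0 , refl , z≤n , λ ()
  scan-spec (v ∷ vs) s with isPos (dem s v) in v-pos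
  ... | true  = 2 , refl , ≤-reflexive (+-comm 2 (2 * length (v ∷ vs))) , λ { refl → v-pos }
  ... | false with scan-spec vs (record s { ticks = suc (suc (ticks s)) })
  ...   | k , scan≡ , k≤ , found-pos = 2 + k , trans scan≡ (cong (λ t → record s { ticks = t }) (+-suc-suc k (ticks s)))
          , ≤-trans (≤-reflexive (+-assoc 2 k _)) (≤-trans (+-monoʳ-≤ 2 k≤) (≤-reflexive (two-more (length vs)))) , found-pos
    where
    two-more : ∀ L → 2 + (2 * L + 2) ≡ 2 * suc L + 2
    two-more = solve-∀
    +-suc-suc : ∀ k t → k + suc (suc t) ≡ 2 + k + t
    +-suc-suc = solve-∀

  scan-amortized : ∀ {k t Φ₀ Φ₁ P R} → Φ₁ + 2 * P ≡ Φ₀ + 2 * R → k + 2 * R ≤ 2 * P + 2 →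
                   suc (k + suc (suc t)) + Φ₁ ≤ t + Φ₀ + 5
  scan-amortized {k} {t} {Φ₀} {Φ₁} {P} {R} Φ₁≡ k≤ = +-cancelʳ-≤ (2 * P) _ _ (begin
    suc (k + suc (suc t)) + Φ₁ + 2 * P  ≡⟨ regroup k t Φ₁ (2 * P) ⟩
    3 + t + k + (Φ₁ + 2 * P)            ≡⟨ cong (λ x → 3 + t + k + x) Φ₁≡ ⟩
    3 + t + k + (Φ₀ + 2 * R)            ≡⟨ regroup′ t k Φ₀ (2 * R) ⟩
    3 + t + Φ₀ + (k + 2 * R)            ≤⟨ +-monoʳ-≤ (3 + t + Φ₀) k≤ ⟩
    3 + t + Φ₀ + (2 * P + 2)            ≡⟨ regroup″ t Φ₀ (2 * P) ⟩
    t + Φ₀ + 5 + 2 * P                  ∎)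
    where
    open ≤-Reasoning
    regroup : ∀ k t x p → suc (k + suc (suc t)) + x + p ≡ 3 + t + k + (x + p)
    regroup = solve-∀
    regroup′ : ∀ t k x r → 3 + t + k + (x + r) ≡ 3 + t + x + (k + r)
    regroup′ = solve-∀
    regroup″ : ∀ t x p → 3 + t + x + (p + 2) ≡ t + x + 5 + p
    regroup″ = solve-∀

  sendAgent-spec : ∀ u t s → Amortized 5 s (proj₂ (sendAgent u t s))
  sendAgent-spec u t s with isNeg (dem s u) in u-neg
  ... | true with parent s u
  ...   | nothing = record { children≡ = refl ; agents≡ = refl ; processed≡ = refl ; lists-grow = λ _ → ≤-refl
                           ; cost = ≤-trans (≤-reflexive (+-comm 2 (Φ⁺ s))) (+-monoʳ-≤ (Φ⁺ s) (m≤m+n 2 3)) }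
  ...   | just q  = record { children≡ = refl ; agents≡ = refl ; processed≡ = refl ; lists-grow = appended-grows (lst s) q (suc t)
                           ; cost = +-cancelʳ-≤ 13 _ _ (begin
      8 + ticks s + Φ s₂ + 13    ≡⟨ regroup (ticks s) (Φ s₂) ⟩
      ticks s + (Φ s₂ + 18) + 3  ≤⟨ +-monoˡ-≤ 3 (+-monoʳ-≤ (ticks s) (≤-trans (Φ-withDemand s₁ u _ (∣z+1∣+1 (dem s u) u-neg)) (Φ-withList s q _ (≤-reflexive (length-++ (lst s q)))))) ⟩
      ticks s + (Φ s + 6 * 1) + 3 ≤⟨ ≤-reflexive (regroup′ (ticks s) (Φ s)) ⟩
      Φ⁺ s + 9                   ≤⟨ +-monoʳ-≤ (Φ⁺ s) (m≤m+n 9 9) ⟩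
      Φ⁺ s + (5 + 13)            ≡⟨ +-assoc (Φ⁺ s) 5 13 ⟨
      Φ⁺ s + 5 + 13              ∎) }
    where
    open ≤-Reasoning
    s₁ = withList s q (lst s q ++ [ suc t ])
    s₂ = withDemand s₁ u (dem s u ℤ.+ + 1)
    regroup : ∀ t p → 8 + t + p + 13 ≡ t + (p + 18) + 3
    regroup = solve-∀
    regroup′ : ∀ t p → t + (p + 6 * 1) + 3 ≡ t + p + 9
    regroup′ = solve-∀
  sendAgent-spec u t s | false with scan (pend s u) (record s { ticks = suc (suc (ticks s)) })
                                  | scan-spec (pend s u) (record s { ticks = suc (suc (ticks s)) })
  ... | (found , rest) , _ | k , refl , k≤ , found-pos with found | found-pos
  ...   | nothing | _ = record { children≡ = refl ; agents≡ = refl ; processed≡ = refl ; lists-grow = λ _ → ≤-refl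
                               ; cost = scan-amortized {k} {ticks s} {Φ s} {Φ (withPending s u rest)} {length (pend s u)} {length rest} (Φ-withPending s u rest) k≤ }
  ...   | just v | v-pos = record { children≡ = refl ; agents≡ = refl ; processed≡ = refl ; lists-grow = appended-grows (lst s) v (suc t)
                              ; cost = ≤-trans (≤-reflexive (regroup (suc (k + suc (suc (ticks s)))) (Φ s₃)))
                                         (≤-trans (+-monoʳ-≤ (suc (k + suc (suc (ticks s)))) Φ₃+7≤)
                                           (scan-amortized {k} {ticks s} {Φ s} {Φ (withPending s u rest)} {length (pend s u)} {length rest} (Φ-withPending s u rest) k≤)) }
    where
    s₁ = withPending s u rest
    s₂ = withList s₁ v (lst s v ++ [ suc t ])
    s₃ = withDemand s₂ v (dem s v ℤ.- + 1)
    Φ₃+7≤ : Φ s₃ + 7 ≤ Φ s₁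
    Φ₃+7≤ = +-cancelʳ-≤ 11 _ _ (begin
      Φ s₃ + 7 + 11     ≡⟨ +-assoc (Φ s₃) 7 11 ⟩
      Φ s₃ + 18         ≤⟨ Φ-withDemand s₂ v _ (∣z-1∣+1 (dem s v) (v-pos refl)) ⟩
      Φ s₂              ≤⟨ Φ-withList s₁ v _ (≤-reflexive (length-++ (lst s v))) ⟩
      Φ s₁ + 6 * 1      ≤⟨ +-monoʳ-≤ (Φ s₁) (m≤m+n 6 5) ⟩
      Φ s₁ + 11         ∎)
      where open ≤-Reasoning
    regroup : ∀ x d → 7 + x + d ≡ x + (d + 7)
    regroup = solve-∀

  sendAll-spec : ∀ u ls s → Amortized (6 * length ls) s (proj₂ (forM_ ls (λ t → sendAgent u t) s))
  sendAll-spec u []       s = ticks-Amortized s 0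
  sendAll-spec u (t ∷ ts) s = subst (λ k → Amortized k s (proj₂ (forM_ ts (λ t → sendAgent u t) s₁))) (six-more (length ts))
    (Amortized-trans (Amortized-trans (ticks-Amortized s 1) (sendAgent-spec u t _)) (sendAll-spec u ts s₁))
    where
    s₁ = proj₂ (sendAgent u t (record s { ticks = suc (ticks s) }))
    six-more : ∀ L → 1 + 5 + 6 * L ≡ 6 * suc L
    six-more = solve-∀

  prependAgentTime : Fin n → M ⊤
  prependAgentTime u = do
    a ← rd agentA u
    when a (do
      su ← rd sv u
      prependL u su)

  sendAllAndMark : Fin n → M ⊤
  sendAllAndMark u = do
    ls ← rd lst u
    forM_ ls (λ t → sendAgent u t)
    setProcessed u true

  prependAgentTime-spec : ∀ u s → Amortized (1 + 11 * bit (agentA s u)) s (proj₂ (prependAgentTime u s))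
  prependAgentTime-spec u s with agentA s u
  ... | true  = record { children≡ = refl ; agents≡ = refl ; processed≡ = refl ; lists-grow = prepended-grows (lst s) u (sv s u)
                       ; cost = ≤-trans (+-monoʳ-≤ (6 + ticks s) (Φ-withList s u (sv s u ∷ lst s u) (≤-reflexive (+-comm 1 _))))
                                        (≤-reflexive (regroup (ticks s) (Φ s))) }
    where
    regroup : ∀ t p → 6 + t + (p + 6 * 1) ≡ t + p + (1 + 11 * 1)
    regroup = solve-∀
  ... | false = record { children≡ = refl ; agents≡ = refl ; processed≡ = refl ; lists-grow = λ _ → ≤-refl
                       ; cost = ≤-reflexive (regroup (ticks s) (Φ s)) }
    where
    regroup : ∀ t p → suc t + p ≡ t + p + (1 + 11 * 0)
    regroup = solve-∀

  record Marked (u : Fin n) (s s′ : St) : Set where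
    field
      children≡  : children s′ ≡ children s
      agents≡    : agentA s′ ≡ agentA s
      lists-grow : ∀ x → length (lst s x) ≤ length (lst s′ x)
      marked     : processed s′ u ≡ true
      others≡    : ∀ {x} → x ≢ u → processed s′ x ≡ processed s x
      cost       : Φ⁺ s′ + setupCost (agentA s u) (children s u) ≤ Φ⁺ s + 2

  -- Processing u releases its unprocessed potential, which pays for one send_agent per entry of l(u).
  sendAllAndMark-spec : ∀ u s → processed s u ≡ false → Marked u s (proj₂ (sendAllAndMark u s))
  sendAllAndMark-spec u s unprocessed = record
    { children≡  = children≡
    ; agents≡    = agents≡
    ; lists-grow = lists-grow
    ; marked     = upd-≡ (processed s₁) u true
    ; others≡    = λ x≢u → trans (upd-≢ (processed s₁) u true x≢u) (cong-app processed≡ _)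
    ; cost       = +-cancelʳ-≤ (6 * L) _ _ (begin
        suc (ticks s₁) + Φ s₂ + W + 6 * L                 ≤⟨ +-monoʳ-≤ (suc (ticks s₁) + Φ s₂ + W) (*-monoʳ-≤ 6 (lists-grow u)) ⟩
        suc (ticks s₁) + Φ s₂ + W + 6 * length (lst s₁ u)  ≡⟨ cong (λ w → suc (ticks s₁) + Φ s₂ + w + 6 * length (lst s₁ u)) W≡ ⟨
        suc (ticks s₁) + Φ s₂ + W₁ + 6 * length (lst s₁ u) ≡⟨ regroup (ticks s₁) (Φ s₂) (6 * length (lst s₁ u)) W₁ ⟩
        suc (ticks s₁) + (Φ s₂ + (6 * length (lst s₁ u) + W₁)) ≡⟨ cong (λ p → suc (ticks s₁) + p) (Φ-withProcessed s₁ u (trans (cong-app processed≡ u) unprocessed)) ⟩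
        suc (Φ⁺ s₁)                                       ≤⟨ s≤s cost ⟩
        suc (suc (ticks s) + Φ s + 6 * L)                  ≡⟨ regroup′ (ticks s) (Φ s) (6 * L) ⟩
        Φ⁺ s + 2 + 6 * L                                   ∎) }
    where
    open ≤-Reasoning
    L = length (lst s u)
    W = setupCost (agentA s u) (children s u)
    s₀ = record s { ticks = suc (ticks s) }
    s₁ = proj₂ (forM_ (lst s u) (λ t → sendAgent u t) s₀)
    s₂ = withProcessed s₁ u
    open Amortized (sendAll-spec u (lst s u) s₀)
    W₁ = setupCost (agentA s₁ u) (children s₁ u)
    W≡ : W₁ ≡ W
    W≡ = cong₂ (λ a c → setupCost (a u) (c u)) agents≡ children≡
    regroup : ∀ t a b w → suc t + a + w + b ≡ suc t + (a + (b + w))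
    regroup = solve-∀
    regroup′ : ∀ t a b → suc (suc t + a + b) ≡ t + a + 2 + b
    regroup′ = solve-∀

  module Subtrees (parentOf : Fin n → Maybe (Fin n)) (rank : Fin n → ℕ)
                  (rank-parent : ∀ {u v} → parentOf v ≡ just u → rank v < rank u)
                  (childrenOf : Fin n → List (Fin n))
                  (childrenOf⇒parent : ∀ {u v} → v ∈ childrenOf u → parentOf v ≡ just u)
                  (childrenOf-unique : ∀ u → Unique (childrenOf u)) where

    data InSubtree (a : Fin n) : Fin n → Set where
      root  : InSubtree a a
      below : ∀ {w x} → parentOf w ≡ just x → InSubtree a x → InSubtree a w

    InSubtree-rank : ∀ {a w} → InSubtree a w → rank w ≤ rank a
    InSubtree-rank root              = ≤-refl
    InSubtree-rank (below w↑x x∈Tₐ) = ≤-trans (<⇒≤ (rank-parent w↑x)) (InSubtree-rank x∈Tₐ)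

    InSubtree-parent : ∀ {u v w} → parentOf v ≡ just u → InSubtree v w → InSubtree u w
    InSubtree-parent v↑u root             = below v↑u root
    InSubtree-parent v↑u (below w↑x x∈Tᵥ) = below w↑x (InSubtree-parent v↑u x∈Tᵥ)

    InSubtree-comparable : ∀ {a b w} → InSubtree a w → InSubtree b w → InSubtree a b ⊎ InSubtree b a
    InSubtree-comparable root               w∈T_b             = inj₂ w∈T_b
    InSubtree-comparable (below w↑x x∈Tₐ)   root              = inj₁ (below w↑x x∈Tₐ)
    InSubtree-comparable (below w↑x x∈Tₐ)   (below w↑y y∈T_b) with just-injective (trans (sym w↑x) w↑y)
    ... | refl = InSubtree-comparable x∈Tₐ y∈T_b

    parent∉subtree : ∀ {u v} → parentOf v ≡ just u → ¬ InSubtree v u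
    parent∉subtree v↑u u∈Tᵥ = <-irrefl refl (≤-trans (rank-parent v↑u) (InSubtree-rank u∈Tᵥ))

    sibling∉subtree : ∀ {u a b} → parentOf a ≡ just u → parentOf b ≡ just u → a ≢ b → ¬ InSubtree a b
    sibling∉subtree a↑u b↑u a≢b root              = a≢b refl
    sibling∉subtree a↑u b↑u a≢b (below b↑x x∈Tₐ) with just-injective (trans (sym b↑x) b↑u)
    ... | refl = parent∉subtree a↑u x∈Tₐ

    siblings-disjoint : ∀ {u a b w} → parentOf a ≡ just u → parentOf b ≡ just u → a ≢ b → InSubtree a w → ¬ InSubtree b w
    siblings-disjoint a↑u b↑u a≢b w∈Tₐ w∈T_b with InSubtree-comparable w∈Tₐ w∈T_b
    ... | inj₁ b∈Tₐ = sibling∉subtree a↑u b↑u a≢b b∈Tₐ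
    ... | inj₂ a∈T_b = sibling∉subtree b↑u a↑u (λ b≡a → a≢b (sym b≡a)) a∈T_b

    SubtreeUnprocessed : St → Fin n → Set
    SubtreeUnprocessed s v = ∀ {w} → InSubtree v w → processed s w ≡ false

    InChildSubtree : List (Fin n) → Fin n → Set
    InChildSubtree cs w = ∃ λ v → v ∈ cs × InSubtree v w

    record Run (Scope : Fin n → Set) (s s′ : St) : Set where
      field
        children≡       : children s′ ≡ children s
        agents≡         : agentA s′ ≡ agentA s
        lists-grow      : ∀ x → length (lst s x) ≤ length (lst s′ x)
        processed-grows : ∀ {x} → processed s x ≡ true → processed s′ x ≡ true
        outside≡        : ∀ {w} → ¬ Scope w → processed s′ w ≡ processed s w

    Run-trans : ∀ {Scope s₁ s₂ s₃} → Run Scope s₁ s₂ → Run Scope s₂ s₃ → Run Scope s₁ s₃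
    Run-trans R₁₂ R₂₃ = record
      { children≡       = trans (children≡ R₂₃) (children≡ R₁₂)
      ; agents≡         = trans (agents≡ R₂₃) (agents≡ R₁₂)
      ; lists-grow      = λ x → ≤-trans (lists-grow R₁₂ x) (lists-grow R₂₃ x)
      ; processed-grows = λ px → processed-grows R₂₃ (processed-grows R₁₂ px)
      ; outside≡        = λ w∉ → trans (outside≡ R₂₃ w∉) (outside≡ R₁₂ w∉) }
      where open Run

    Run-widen : ∀ {Scope Scope′ s s′} → (∀ {w} → Scope w → Scope′ w) → Run Scope s s′ → Run Scope′ s s′
    Run-widen Scope⊆ R = record { Run R ; outside≡ = λ w∉ → Run.outside≡ R (λ w∈ → w∉ (Scope⊆ w∈)) }

    Amortized⇒Run : ∀ {Scope k s s′} → Amortized k s s′ → Run Scope s s′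
    Amortized⇒Run A = record
      { children≡       = children≡
      ; agents≡         = agents≡
      ; lists-grow      = lists-grow
      ; processed-grows = λ {x} px → trans (cong-app processed≡ x) px
      ; outside≡        = λ {w} _ → cong-app processed≡ w }
      where open Amortized A

    record SubtreeRun (u : Fin n) (k : ℕ) (s s′ : St) : Set where
      field
        run      : Run (InSubtree u) s s′
        cost     : Φ⁺ s′ ≤ Φ⁺ s + k
        finished : processed s′ u ≡ true ⊎ processed s′ ≡ processed s

    record ChildrenRun (cs : List (Fin n)) (k : ℕ) (s s′ : St) : Set where
      field
        run  : Run (InChildSubtree cs) s s′
        cost : Φ⁺ s′ ≤ Φ⁺ s + k

    idle : ∀ {u k s s′} → Amortized k s s′ → SubtreeRun u k s s′
    idle A = record { run = Amortized⇒Run A ; cost = Amortized.cost A ; finished = inj₂ (Amortized.processed≡ A) }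

    SubtreeRun-after : ∀ {u j k s s₀ s′} → Amortized j s s₀ → SubtreeRun u k s₀ s′ → SubtreeRun u (j + k) s s′
    SubtreeRun-after {j = j} {k} {s} A R = record
      { run      = Run-trans (Amortized⇒Run A) (SubtreeRun.run R)
      ; cost     = ≤-trans (SubtreeRun.cost R) (≤-trans (+-monoˡ-≤ k (Amortized.cost A)) (≤-reflexive (+-assoc (Φ⁺ s) j k)))
      ; finished = Sum.map₂ (λ p≡ → trans p≡ (Amortized.processed≡ A)) (SubtreeRun.finished R) }

    visitNegativeChild : ℕ → Fin n → Fin n → M ⊤
    visitNegativeChild f u v = do
      dv ← rd dem v
      when (isNeg dv) (do
        su ← rd sv u
        m ← rd maxl u
        setS v ((su ∸ 1) ⊔ m)
        processSubtree f v)

    visitIfUnprocessed : ℕ → Fin n → M ⊤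
    visitIfUnprocessed f v = do
      pv ← rd processed v
      when (if pv then false else true) (processSubtree f v)

    ∈-unique⇒≢ : ∀ {v v′} {vs : List (Fin n)} → Unique (v ∷ vs) → v′ ∈ vs → v ≢ v′
    ∈-unique⇒≢ (v∉vs ∷ _) v′∈ refl = All¬⇒¬Any v∉vs v′∈

    Status : St → Fin n → Set
    Status s v = processed s v ≡ true ⊎ SubtreeUnprocessed s v

    status-outside : ∀ {Scope v s s′} → (∀ {w} → InSubtree v w → ¬ Scope w) → Run Scope s s′ → Status s v → Status s′ v
    status-outside disjoint R (inj₁ v-done) = inj₁ (Run.processed-grows R v-done)
    status-outside disjoint R (inj₂ fresh) = inj₂ (λ w∈Tᵥ → trans (Run.outside≡ R (disjoint w∈Tᵥ)) (fresh w∈Tᵥ))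

    first-apart : ∀ {u v vs} → (∀ {v′} → v′ ∈ v ∷ vs → parentOf v′ ≡ just u) → Unique (v ∷ vs) →
                  ∀ {w} → InSubtree v w → ¬ InChildSubtree vs w
    first-apart child↑ !v∷vs w∈Tᵥ (v′ , v′∈ , w∈Tᵥ′) =
      siblings-disjoint (child↑ (here refl)) (child↑ (there v′∈)) (∈-unique⇒≢ !v∷vs v′∈) w∈Tᵥ w∈Tᵥ′

    Marked⇒Run : ∀ {u s s′} → Marked u s s′ → Run (_≡ u) s s′
    Marked⇒Run {u} M = record
      { children≡       = Marked.children≡ M
      ; agents≡         = Marked.agents≡ M
      ; lists-grow      = Marked.lists-grow M
      ; processed-grows = λ {x} px → by-cases-≟ x u (λ { refl → Marked.marked M }) (λ x≢u → trans (Marked.others≡ M x≢u) px)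
      ; outside≡        = Marked.others≡ M }

    ChildrenRun-cons : ∀ {u v vs j k s s₁ s₂} → (∀ {v′} → v′ ∈ v ∷ vs → parentOf v′ ≡ just u) →
                       SubtreeRun v j (record s { ticks = suc (ticks s) }) s₁ → ChildrenRun vs k s₁ s₂ → ChildrenRun (v ∷ vs) (suc (j + k)) s s₂
    ChildrenRun-cons {j = j} {k} {s} child↑ R₁ R₂ = record
      { run  = Run-trans (Amortized⇒Run (ticks-Amortized s 1))
                 (Run-trans (Run-widen (λ w∈Tᵥ → _ , here refl , w∈Tᵥ) (SubtreeRun.run R₁))
                            (Run-widen (λ { (v′ , v′∈ , w∈) → v′ , there v′∈ , w∈ }) (ChildrenRun.run R₂)))
      ; cost = ≤-trans (ChildrenRun.cost R₂) (≤-trans (+-monoˡ-≤ k (SubtreeRun.cost R₁)) (≤-reflexive (regroup (Φ⁺ s) j k))) }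
      where
      regroup : ∀ p j k → suc p + j + k ≡ p + suc (j + k)
      regroup = solve-∀

    process-cost : ∀ {p₀ p₁ p₃ p₆ p₇ a c} → p₁ ≤ p₀ + (1 + 11 * a) → p₃ ≤ suc p₁ + 5 * c →
                   p₆ + (11 * a + 4 + 7 * c) ≤ p₃ + 2 → p₇ ≤ p₆ + 2 * c → p₇ ≤ p₀ + 0
    process-cost {p₀} {p₁} {p₃} {p₆} {p₇} {a} {c} c₁ c₃ c₆ c₇ = +-cancelʳ-≤ W p₇ (p₀ + 0) (begin
      p₇ + W                                 ≤⟨ +-monoˡ-≤ W c₇ ⟩
      p₆ + 2 * c + W                         ≡⟨ regroup p₆ (2 * c) W ⟩
      p₆ + W + 2 * c                         ≤⟨ +-monoˡ-≤ (2 * c) c₆ ⟩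
      p₃ + 2 + 2 * c                         ≤⟨ +-monoˡ-≤ (2 * c) (+-monoˡ-≤ 2 c₃) ⟩
      suc p₁ + 5 * c + 2 + 2 * c             ≤⟨ +-monoˡ-≤ (2 * c) (+-monoˡ-≤ 2 (+-monoˡ-≤ (5 * c) (s≤s c₁))) ⟩
      suc (p₀ + (1 + 11 * a)) + 5 * c + 2 + 2 * c ≡⟨ regroup′ p₀ a c ⟩
      p₀ + 0 + W                             ∎)
      where
      open ≤-Reasoning
      W = 11 * a + 4 + 7 * c
      regroup : ∀ x y z → x + y + z ≡ x + z + y
      regroup = solve-∀
      regroup′ : ∀ p a c → suc (p + (1 + 11 * a)) + 5 * c + 2 + 2 * c ≡ p + 0 + (11 * a + 4 + 7 * c)
      regroup′ = solve-∀

    mutual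
      processSubtree-spec : ∀ f u s → children s ≡ childrenOf → SubtreeUnprocessed s u →
                            SubtreeRun u 0 s (proj₂ (processSubtree f u s))
      processSubtree-spec zero    u s _ _ = idle (ticks-Amortized s 0)
      processSubtree-spec (suc f) u s ch≡ u-fresh = record
        { run      = Run-trans (Amortized⇒Run A₁) (Run-trans (Amortized⇒Run (ticks-Amortized s₁ 1))
                       (Run-trans (Run-widen inside R₃) (Run-trans (Run-widen (λ { refl → root }) (Marked⇒Run M₆)) (Run-widen inside R₇))))
        ; cost     = process-cost {Φ⁺ s} {Φ⁺ s₁} {Φ⁺ s₃} {Φ⁺ s₆} {Φ⁺ s₇} {bit (agentA s u)} {length cs}
                       (Amortized.cost A₁) (ChildrenRun.cost (proj₁ L₃)) marked-cost (ChildrenRun.cost L₇)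
        ; finished = inj₁ (Run.processed-grows R₇ (Marked.marked M₆)) }
        where
        s₁ s₂ s₃ s₆ s₇ : St
        cs : List (Fin n)
        s₁ = proj₂ (prependAgentTime u s)
        s₂ = record s₁ { ticks = suc (ticks s₁) }
        s₃ = proj₂ (forM_ cs (visitNegativeChild f u) s₂)
        s₆ = proj₂ (sendAllAndMark u s₃)
        s₇ = proj₂ (forM_ cs (visitIfUnprocessed f) s₆)
        cs = children s₁ u
        A₁ : Amortized (1 + 11 * bit (agentA s u)) s s₁
        A₁ = prependAgentTime-spec u s
        ch₁≡ : children s₁ ≡ childrenOf
        ch₁≡ = trans (Amortized.children≡ A₁) ch≡
        child↑u : ∀ {v} → v ∈ cs → parentOf v ≡ just u
        child↑u v∈ = childrenOf⇒parent (subst (_ ∈_) (cong-app ch₁≡ u) v∈)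
        !cs : Unique cs
        !cs = subst Unique (sym (cong-app ch₁≡ u)) (childrenOf-unique u)
        inside : ∀ {w} → InChildSubtree cs w → InSubtree u w
        inside (v , v∈ , w∈Tᵥ) = InSubtree-parent (child↑u v∈) w∈Tᵥ
        L₃ : ChildrenRun cs (5 * length cs) s₂ s₃ × (∀ {v} → v ∈ cs → Status s₃ v)
        L₃ = visitNegatives-spec f u cs s₂ ch₁≡ child↑u !cs
               (λ v∈ w∈Tᵥ → trans (cong-app (Amortized.processed≡ A₁) _) (u-fresh (inside (_ , v∈ , w∈Tᵥ))))
        R₃ : Run (InChildSubtree cs) s₂ s₃
        R₃ = ChildrenRun.run (proj₁ L₃)
        M₆ : Marked u s₃ s₆
        M₆ = sendAllAndMark-spec u s₃ (trans (Run.outside≡ R₃ (λ { (v , v∈ , u∈Tᵥ) → parent∉subtree (child↑u v∈) u∈Tᵥ }))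
                                        (trans (cong-app (Amortized.processed≡ A₁) u) (u-fresh root)))
        L₇ : ChildrenRun cs (2 * length cs) s₆ s₇
        L₇ = visitUnprocessed-spec f u cs s₆ (trans (Marked.children≡ M₆) (trans (Run.children≡ R₃) ch₁≡)) child↑u !cs
               (λ v∈ → status-outside (λ w∈Tᵥ w≡u → parent∉subtree (child↑u v∈) (subst (InSubtree _) w≡u w∈Tᵥ))
                                      (Marked⇒Run M₆) (proj₂ L₃ v∈))
        R₇ : Run (InChildSubtree cs) s₆ s₇
        R₇ = ChildrenRun.run L₇
        marked-cost : Φ⁺ s₆ + (11 * bit (agentA s u) + 4 + 7 * length cs) ≤ Φ⁺ s₃ + 2
        marked-cost = subst (λ W → Φ⁺ s₆ + W ≤ Φ⁺ s₃ + 2)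
          (cong₂ (λ a c → setupCost (a u) (c u)) (trans (Run.agents≡ R₃) (Amortized.agents≡ A₁)) (Run.children≡ R₃))
          (Marked.cost M₆)

      visitNegativeChild-spec : ∀ f u v s → children s ≡ childrenOf → parentOf v ≡ just u → SubtreeUnprocessed s v →
                                SubtreeRun v 4 s (proj₂ (visitNegativeChild f u v s))
      visitNegativeChild-spec f u v s ch≡ v↑u v-fresh with isNeg (dem s v)
      ... | true  = SubtreeRun-after setS-Amortized (processSubtree-spec f v s′ ch≡ v-fresh)
        where
        s′ = record s { ticks = 4 + ticks s ; sv = upd (sv s) v ((sv s u ∸ 1) ⊔ maxl s u) }
        setS-Amortized : Amortized 4 s s′
        setS-Amortized = record { Amortized (ticks-Amortized s 4) }
      ... | false = idle (record { Amortized (ticks-Amortized s 1)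
                                 ; cost = ≤-trans (Amortized.cost (ticks-Amortized s 1)) (+-monoʳ-≤ (Φ⁺ s) (m≤m+n 1 3)) })

      visitNegatives-spec : ∀ f u cs s → children s ≡ childrenOf → (∀ {v} → v ∈ cs → parentOf v ≡ just u) → Unique cs →
                            (∀ {v} → v ∈ cs → SubtreeUnprocessed s v) →
                            ChildrenRun cs (5 * length cs) s (proj₂ (forM_ cs (visitNegativeChild f u) s)) ×
                            (∀ {v} → v ∈ cs → Status (proj₂ (forM_ cs (visitNegativeChild f u) s)) v)
      visitNegatives-spec f u []       s _ _ _ _ = record { run = Amortized⇒Run (ticks-Amortized s 0) ; cost = m≤m+n _ 0 } , λ ()
      visitNegatives-spec f u (v ∷ vs) s ch≡ child↑ !v∷vs fresh =
        subst (λ k → ChildrenRun (v ∷ vs) k s s₂) (five-more (length vs)) (ChildrenRun-cons child↑ R₁ (proj₁ rest)) , status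
        where
        s₀ s₁ s₂ : St
        s₀ = record s { ticks = suc (ticks s) }
        s₁ = proj₂ (visitNegativeChild f u v s₀)
        s₂ = proj₂ (forM_ vs (visitNegativeChild f u) s₁)
        R₁ : SubtreeRun v 4 s₀ s₁
        R₁ = visitNegativeChild-spec f u v s₀ ch≡ (child↑ (here refl)) (fresh (here refl))
        rest : ChildrenRun vs (5 * length vs) s₁ s₂ × (∀ {v′} → v′ ∈ vs → Status s₂ v′)
        rest = visitNegatives-spec f u vs s₁ (trans (Run.children≡ (SubtreeRun.run R₁)) ch≡) (λ v′∈ → child↑ (there v′∈)) (tail !v∷vs)
                 (λ v′∈ w∈Tᵥ′ → trans (Run.outside≡ (SubtreeRun.run R₁) (λ w∈Tᵥ → first-apart child↑ !v∷vs w∈Tᵥ (_ , v′∈ , w∈Tᵥ′)))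
                                      (fresh (there v′∈) w∈Tᵥ′))
        status : ∀ {v′} → v′ ∈ v ∷ vs → Status s₂ v′
        status (there v′∈) = proj₂ rest v′∈
        status (here refl) = status-outside (first-apart child↑ !v∷vs) (ChildrenRun.run (proj₁ rest))
          (Sum.map₂ (λ p≡ w∈Tᵥ → trans (cong-app p≡ _) (fresh (here refl) w∈Tᵥ)) (SubtreeRun.finished R₁))
        five-more : ∀ L → suc (4 + 5 * L) ≡ 5 * suc L
        five-more = solve-∀

      visitUnprocessed-spec : ∀ f u cs s → children s ≡ childrenOf → (∀ {v} → v ∈ cs → parentOf v ≡ just u) → Unique cs →
                              (∀ {v} → v ∈ cs → Status s v) →
                              ChildrenRun cs (2 * length cs) s (proj₂ (forM_ cs (visitIfUnprocessed f) s))
      visitUnprocessed-spec f u []       s _ _ _ _ = record { run = Amortized⇒Run (ticks-Amortized s 0) ; cost = m≤m+n _ 0 }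
      visitUnprocessed-spec f u (v ∷ vs) s ch≡ child↑ !v∷vs status =
        subst (λ k → ChildrenRun (v ∷ vs) k s s₂) (two-more (length vs)) (ChildrenRun-cons child↑ R₁ rest)
        where
        s₀ s₁ s₂ : St
        s₀ = record s { ticks = suc (ticks s) }
        s₁ = proj₂ (visitIfUnprocessed f v s₀)
        s₂ = proj₂ (forM_ vs (visitIfUnprocessed f) s₁)
        R₁ : SubtreeRun v 1 s₀ s₁
        R₁ = visitIfUnprocessed-spec f v s₀ ch≡ (status (here refl))
        rest : ChildrenRun vs (2 * length vs) s₁ s₂
        rest = visitUnprocessed-spec f u vs s₁ (trans (Run.children≡ (SubtreeRun.run R₁)) ch≡) (λ v′∈ → child↑ (there v′∈)) (tail !v∷vs)
                 (λ v′∈ → status-outside (λ w∈Tᵥ′ w∈Tᵥ → first-apart child↑ !v∷vs w∈Tᵥ (_ , v′∈ , w∈Tᵥ′)) (SubtreeRun.run R₁) (status (there v′∈)))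
        two-more : ∀ L → suc (1 + 2 * L) ≡ 2 * suc L
        two-more = solve-∀

      visitIfUnprocessed-spec : ∀ f v s → children s ≡ childrenOf → Status s v → SubtreeRun v 1 s (proj₂ (visitIfUnprocessed f v s))
      visitIfUnprocessed-spec f v s ch≡ status with processed s v in pv
      ... | true  = idle (ticks-Amortized s 1)
      ... | false with status
      ...   | inj₁ ()
      ...   | inj₂ fresh = SubtreeRun-after (ticks-Amortized s 1) (processSubtree-spec f v _ ch≡ fresh)

module _ {n : ℕ} (E : List (Edge n)) (r : Fin n) (A T : List (Fin n)) where
  open Algorithm n using (St; M)

  -- The fuel is kept abstract (also in dfsRun′ and processSubtree-run below): with the concrete fuel suc n,
  -- checking these equations by conversion would unfold the whole program.
  Phases : ℕ → ℕ → M ⊤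
  Phases F F′ = let open Algorithm n using (_>>=_; _>>_) in do
    Algorithm.readInput n E A T
    Algorithm.setVisited n r true
    order ← Algorithm.dfs n F [ r ] []
    Algorithm.initPass n order
    Algorithm.accPass n order
    Algorithm.processSubtree n F′ r

  steps-phases : Algorithm.steps n E r A T ≡ St.ticks (proj₂ (Phases (suc n) (suc n) (Algorithm.st₀ n)))
  steps-phases = refl

  ticks-after-phases : ∀ F F′ {s₁ s₂ s₃ s₄ s₅} → proj₂ (Algorithm.readInput n E A T (Algorithm.st₀ n)) ≡ s₁ →
    proj₂ (Algorithm.setVisited n r true s₁) ≡ s₂ → proj₂ (Algorithm.dfs n F [ r ] [] s₂) ≡ s₃ →
    proj₂ (Algorithm.initPass n (proj₁ (Algorithm.dfs n F [ r ] [] s₂)) s₃) ≡ s₄ →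
    proj₂ (Algorithm.accPass n (proj₁ (Algorithm.dfs n F [ r ] [] s₂)) s₄) ≡ s₅ →
    St.ticks (proj₂ (Phases F F′ (Algorithm.st₀ n))) ≡ St.ticks (proj₂ (Algorithm.processSubtree n F′ r s₅))
  ticks-after-phases F F′ refl refl refl refl refl = refl

module Analysis {m : ℕ} (E : List (Edge (suc m))) (tree : IsTree (suc m) E) (r : Fin (suc m)) (A T : List (Fin (suc m))) where
  open Algorithm (suc m)
  open St

  nbrs : Fin (suc m) → List (Fin (suc m))
  nbrs = addEdges E (λ _ → [])

  open Dfs r nbrs

  sRead sRoot : St
  sRead = afterReadInput E A T st₀
  sRoot = record sRead { ticks = suc (ticks sRead) ; visited = upd (visited sRead) r true }

  dfsRun′ : ∀ F → F ≡ suc (suc m) →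
            DfsResult [ r ] sRoot (proj₁ (Algorithm.dfs (suc m) F [ r ] [] sRoot)) (proj₂ (Algorithm.dfs (suc m) F [ r ] [] sRoot))
  dfsRun′ F F≡ = dfs-spec F [ r ] [] sRoot (initial-invariant sRead (λ _ → refl) (λ _ → refl) (λ _ → refl) (λ _ → refl)) F≡

  order : List (Fin (suc m))
  order = proj₁ (Algorithm.dfs (suc m) (suc (suc m)) [ r ] [] sRoot)

  sDfs sTree sInit sAcc : St
  sDfs  = proj₂ (Algorithm.dfs (suc m) (suc (suc m)) [ r ] [] sRoot)
  sTree = record sRoot { ticks = ticks sDfs ; visited = visited sDfs ; parent = parent sDfs ; children = children sDfs }
  sInit = record sTree { ticks = 6 * length order + ticks sTree ; dem = updAll order (dem sTree) (ownDemand sTree)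
                       ; pend = updAll order (pend sTree) (children sTree) }
  sAcc  = record sInit { ticks = accPassCost (parent sInit) order + ticks sInit
                       ; dem = Accumulation.accumulate (parent sInit) order (dem sInit) }

  dfsRun : DfsResult [ r ] sRoot order sDfs
  dfsRun = dfsRun′ (suc (suc m)) refl

  steps≡ : Algorithm.steps (suc m) E r A T ≡ ticks (proj₂ (Algorithm.processSubtree (suc m) (suc (suc m)) r sAcc))
  steps≡ = trans (steps-phases E r A T) (ticks-after-phases E r A T (suc (suc m)) (suc (suc m)) {sRead} {sRoot} {sTree} {sInit} {sAcc}
             (readInput-effect E A T st₀) refl (DfsResult.fields-only dfsRun) (initPass-effect order sTree) (accPass-effect order sInit))

  open Invariant (DfsResult.invariant dfsRun)

  order-complete : ∀ x → x ∈ order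
  order-complete x with visited⇒seen root-visited
  ... | inj₂ r∈order = reachable⇒popped (DfsResult.invariant dfsRun) (adjacent⇒∈-addEdges E _) (proj₂ tree r x) r∈order

  rank-parent : ∀ {x p} → parent sDfs x ≡ just p → position order x < position order p
  rank-parent x↑p = proj₂ (popped-parent-later (order-complete _) x↑p)

  parent-adjacent : ∀ {x p} → parent sDfs x ≡ just p → Adjacent E p x
  parent-adjacent x↑p with ∈-addEdges⁻ E (λ _ → []) _ (parent-nbr x↑p)
  ... | inj₂ px = px

  edge⇒parentEdge : ∀ {a b} → Adjacent E a b → parent sDfs a ≡ just b ⊎ parent sDfs b ≡ just a
  edge⇒parentEdge = ParentEdges.edge⇒parentEdge E (proj₁ tree) r (parent sDfs)
    (λ x x≢r → visited⇒has-parent (popped⇒visited (order-complete x)) x≢r) parent-adjacent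
    (λ x↑y y↑x → <-irrefl refl (<-trans (rank-parent x↑y) (rank-parent y↑x)))

  open ProcessSubtree {suc m}
  open Subtrees (parent sDfs) (position order) rank-parent (children sDfs) children⇒parent children-unique

  processSubtree-run : ∀ F → SubtreeRun r 0 sAcc (proj₂ (Algorithm.processSubtree (suc m) F r sAcc))
  processSubtree-run F = processSubtree-spec F r sAcc refl (λ _ → refl)

  final : St
  final = proj₂ (Algorithm.processSubtree (suc m) (suc (suc m)) r sAcc)

  ticks-final : ticks final ≤ ticks sAcc + Φ sAcc
  ticks-final = ≤-trans (m≤m+n (ticks final) (Φ final)) (≤-trans (SubtreeRun.cost (processSubtree-run (suc (suc m)))) (≤-reflexive (+-identityʳ _)))

  pending≡children : ∀ x → pend sAcc x ≡ children sDfs x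
  pending≡children x = updAll-∈ order (pend sTree) (children sTree) (order-complete x)

  φ-initial≤ : ∀ x → φ sAcc x ≤ 18 * ∣ dem sAcc x ∣ + (9 * length (children sDfs x) + 15)
  φ-initial≤ x rewrite pending≡children x = bound (∣ dem sAcc x ∣) (length (children sDfs x)) (bit (agentA sAcc x)) (bit≤1 (agentA sAcc x))
    where
    bit≤1 : ∀ b → bit b ≤ 1
    bit≤1 true  = ≤-refl
    bit≤1 false = z≤n
    bound : ∀ d c a → a ≤ 1 → 18 * d + 2 * c + (11 * a + 4 + 7 * c) ≤ 18 * d + (9 * c + 15)
    bound d c a a≤1 = ≤-trans (+-monoʳ-≤ (18 * d + 2 * c) (+-monoˡ-≤ (7 * c) (+-monoˡ-≤ 4 (*-monoʳ-≤ 11 a≤1))))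
                              (≤-reflexive (regroup d c))
      where
      regroup : ∀ d c → 18 * d + 2 * c + (11 * 1 + 4 + 7 * c) ≡ 18 * d + (9 * c + 15)
      regroup = solve-∀

  own-demand : ∀ x → dem sInit x ≡ b2z (mem T x) ℤ.- b2z (mem A x)
  own-demand x = trans (updAll-∈ order (dem sTree) (ownDemand sTree) (order-complete x))
                       (cong₂ (λ t a → b2z t ℤ.- b2z a) (markAll-mem T x) (markAll-mem A x))

  Φ-initial≤ : ∀ {plan} → Reaches E (mem T) (mem A) plan → Φ sAcc ≤ 18 * length plan + 24 * suc m
  Φ-initial≤ {plan} reaches = begin
    sum (φ sAcc)                                     ≤⟨ sum-mono-≤ φ-initial≤ ⟩
    sum (λ x → 18 * D x + (9 * C x + 15))            ≡⟨ ∑-distrib-+ (λ x → 18 * D x) (λ x → 9 * C x + 15) ⟩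
    sum (λ x → 18 * D x) + sum (λ x → 9 * C x + 15)  ≡⟨ cong (λ z → sum (λ x → 18 * D x) + z) (∑-distrib-+ (λ x → 9 * C x) (λ _ → 15)) ⟩
    sum (λ x → 18 * D x) + (sum (λ x → 9 * C x) + sum {suc m} (λ _ → 15))
                                                     ≡⟨ cong₂ (λ a b → a + (b + sum {suc m} (λ _ → 15))) (*-distribˡ-sum 18 D) (*-distribˡ-sum 9 C) ⟨
    18 * sum D + (9 * sum C + sum {suc m} (λ _ → 15)) ≤⟨ +-mono-≤ (*-monoʳ-≤ 18 demand≤) (+-mono-≤ (*-monoʳ-≤ 9 children≤) (sum-≤-const {suc m} 15 (λ _ → ≤-refl))) ⟩
    18 * length plan + (9 * suc m + suc m * 15)      ≡⟨ regroup (length plan) (suc m) ⟩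
    18 * length plan + 24 * suc m                    ∎
    where
    open ≤-Reasoning
    D C : Fin (suc m) → ℕ
    D x = ∣ dem sAcc x ∣
    C x = length (children sDfs x)
    demand≤ : sum D ≤ length plan
    demand≤ = PlanFlow.accumulate-demand≤length E (parent sDfs) edge⇒parentEdge popped-unique order-complete rank-parent
                reaches (dem sInit) own-demand
    children≤ : sum C ≤ suc m
    children≤ = children-total (parent sDfs) (children sDfs) children⇒parent children-unique
    regroup : ∀ p n → 18 * p + (9 * n + n * 15) ≡ 18 * p + 24 * n
    regroup = solve-∀

  visitCost-total : sum visitCost ≤ suc m * 2 + 6 * (2 * length E + 0)
  visitCost-total = begin
    sum (λ x → 2 + 6 * length (nbrs x))                     ≡⟨ ∑-distrib-+ (λ _ → 2) (λ x → 6 * length (nbrs x)) ⟩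
    sum {suc m} (λ _ → 2) + sum (λ x → 6 * length (nbrs x)) ≡⟨ cong (λ z → sum {suc m} (λ _ → 2) + z) (*-distribˡ-sum 6 (λ x → length (nbrs x))) ⟨
    sum {suc m} (λ _ → 2) + 6 * totalLength nbrs            ≡⟨ cong (λ t → sum {suc m} (λ _ → 2) + 6 * t) (totalLength-addEdges E (λ _ → [])) ⟩
    sum {suc m} (λ _ → 2) + 6 * (2 * length E + sum {suc m} (λ _ → 0))
                                                            ≡⟨ cong (λ z → sum {suc m} (λ _ → 2) + 6 * (2 * length E + z)) (sum-replicate-zero (suc m)) ⟩
    sum {suc m} (λ _ → 2) + 6 * (2 * length E + 0)          ≤⟨ +-monoˡ-≤ _ (sum-≤-const {suc m} 2 (λ _ → ≤-refl)) ⟩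
    suc m * 2 + 6 * (2 * length E + 0)                      ∎
    where open ≤-Reasoning

  ticks-before-processing : Unique A → Unique T → ticks sAcc ≤ 1 + 34 * suc m
  ticks-before-processing !A !T = begin
    accPassCost (parent sInit) order + (6 * length order + ticks sDfs)
      ≤⟨ +-mono-≤ (≤-trans (accPassCost≤ (parent sInit) order) (*-monoʳ-≤ 5 |order|≤)) (+-mono-≤ (*-monoʳ-≤ 6 |order|≤) dfs-ticks) ⟩
    5 * suc m + (6 * suc m + (suc (2 * length T + (2 * length A + (5 * length E + 0))) + (suc m * 2 + 6 * (2 * length E + 0))))
      ≤⟨ +-monoʳ-≤ (5 * suc m) (+-monoʳ-≤ (6 * suc m) (+-mono-≤
           (s≤s (+-mono-≤ (*-monoʳ-≤ 2 (length-unique !T)) (+-mono-≤ (*-monoʳ-≤ 2 (length-unique !A)) (+-monoˡ-≤ 0 (*-monoʳ-≤ 5 |E|≤)))))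
           (+-monoʳ-≤ (suc m * 2) (*-monoʳ-≤ 6 (+-monoˡ-≤ 0 (*-monoʳ-≤ 2 |E|≤)))))) ⟩
    5 * suc m + (6 * suc m + (suc (2 * suc m + (2 * suc m + (5 * suc m + 0))) + (suc m * 2 + 6 * (2 * suc m + 0))))
      ≡⟨ regroup (suc m) ⟩
    1 + 34 * suc m ∎
    where
    open ≤-Reasoning
    |order|≤ : length order ≤ suc m
    |order|≤ = length-unique popped-unique
    |E|≤ : length E ≤ suc m
    |E|≤ = ≤-trans (≤-reflexive (proj₁ tree)) (m≤n+m m 1)
    dfs-ticks : ticks sDfs ≤ suc (2 * length T + (2 * length A + (5 * length E + 0))) + (suc m * 2 + 6 * (2 * length E + 0))
    dfs-ticks = ≤-trans (DfsResult.cost dfsRun) (+-monoʳ-≤ (ticks sRoot) (≤-trans (≤-reflexive (initial-potential sRead (λ _ → refl))) visitCost-total))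
    regroup : ∀ n → 5 * n + (6 * n + (suc (2 * n + (2 * n + (5 * n + 0))) + (n * 2 + 6 * (2 * n + 0)))) ≡ 1 + 34 * n
    regroup = solve-∀

  steps-bound : Unique A → Unique T → ∀ {plan} → Reaches E (mem T) (mem A) plan →
                Algorithm.steps (suc m) E r A T ≤ 59 * (suc m + length plan)
  steps-bound !A !T {plan} reaches = begin
    Algorithm.steps (suc m) E r A T                   ≡⟨ steps≡ ⟩
    ticks final                                       ≤⟨ ticks-final ⟩
    ticks sAcc + Φ sAcc                               ≤⟨ +-mono-≤ (ticks-before-processing !A !T) (Φ-initial≤ reaches) ⟩
    1 + 34 * suc m + (18 * length plan + 24 * suc m)  ≡⟨ regroup m (length plan) ⟩
    59 + 58 * m + 18 * length plan                    ≤⟨ +-mono-≤ (+-monoʳ-≤ 59 (*-monoˡ-≤ m (n≤1+n 58))) (*-monoˡ-≤ (length plan) (m≤m+n 18 41)) ⟩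
    59 + 59 * m + 59 * length plan                    ≡⟨ regroup′ m (length plan) ⟩
    59 * (suc m + length plan)                        ∎
    where
    open ≤-Reasoning
    regroup : ∀ m p → 1 + 34 * suc m + (18 * p + 24 * suc m) ≡ 59 + 58 * m + 18 * p
    regroup = solve-∀
    regroup′ : ∀ m p → 59 + 59 * m + 59 * p ≡ 59 * (suc m + p)
    regroup′ = solve-∀

mainTheorem8 : ∃ λ (C : ℕ) → (n : ℕ) → 2 ≤ n → (E : List (Edge n)) → IsTree n E →
    (r : Fin n) → (A T : List (Fin n)) → Unique A → Unique T → length A ≡ length T →
    (opt : ℕ) → IsOPT n E A T opt →
    runningTime n E r A T ≤ C * (n * ⌈log₂ n ⌉ + opt * ⌈log₂ n ⌉)
mainTheorem8 = 59 , bound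
  where
  bound : (n : ℕ) → 2 ≤ n → (E : List (Edge n)) → IsTree n E →
    (r : Fin n) → (A T : List (Fin n)) → Unique A → Unique T → length A ≡ length T →
    (opt : ℕ) → IsOPT n E A T opt →
    runningTime n E r A T ≤ 59 * (n * ⌈log₂ n ⌉ + opt * ⌈log₂ n ⌉)
  bound (suc m) _ E tree r A T !A !T _ opt ((plan , reaches , refl) , _) = begin
    Algorithm.steps (suc m) E r A T * ⌈log₂ suc m ⌉          ≤⟨ *-monoˡ-≤ ⌈log₂ suc m ⌉ (Analysis.steps-bound E tree r A T !A !T reaches) ⟩
    59 * (suc m + length plan) * ⌈log₂ suc m ⌉               ≡⟨ distribute (suc m) (length plan) ⌈log₂ suc m ⌉ ⟩
    59 * (suc m * ⌈log₂ suc m ⌉ + length plan * ⌈log₂ suc m ⌉) ∎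
    where
    open ≤-Reasoning
    distribute : ∀ n p L → 59 * (n + p) * L ≡ 59 * (n * L + p * L)
    distribute = solve-∀
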